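{- Let $D=(E,\mathcal{F})$ be a binary delta-matroid in which the empty set is feasible. Then, for some non-negative integers $i,j,k$, there is a sequence of handle slides taking $D$ to $D_{i,j,0}$ if $D$ is even, or to $D_{i,0,k}$ with $k\neq 0$ if $D$ is odd. Furthermore, if some sequences of handle slides take $D$ to $D_{i,j,k}$ and to $D_{p,q,r}$, then $i=p$; consequently $D$ is taken to a unique form $D_{i,j,0}$ or $D_{i,0,k}$ by handle slides.
   Context: A set system is a pair $(E,\mathcal{F})$ with $E$ a finite set and $\mathcal{F}$ a collection of subsets of $E$. A delta-matroid is a set system with $\mathcal{F}$ non-empty satisfying: for all $X,Y\in\mathcal{F}$ and $u\in X\triangle Y$ there is $v\in X\triangle Y$ with $X\triangle\{u,v\}\in\mathcal{F}$ ($\triangle$ is symmetric difference). Elements of $\mathcal{F}$ are feasible sets. $D$ is even if all feasible sets have the same parity of cardinality, odd otherwise. For a symmetric $|E|\times|E|$ matrix $M$ over $GF(2)$ with rows and columns indexed by $E$, $D(M)$ is the set system on $E$ whose feasible sets are the $A\subseteq E$ with principal submatrix $M[A]$ non-singular ($M[\emptyset]$ counts as non-singular). The twist $D*A$ is $(E,\{A\triangle X: X\in\mathcal{F}\})$. $D$ is binary if some twist of $D$ is isomorphic to $D(M)$ for some such matrix $M$ over $GF(2)$. For distinct $a,b\in E$, the handle slide of $a$ over $b$ gives $D_{ab}=(E,\mathcal{F}_{ab})$ with $\mathcal{F}_{ab}=\mathcal{F}\triangle\{X\cup\{a\}: X\cup\{b\}\in\mathcal{F},\ X\subseteq E\setminus\{a,b\}\}$;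 a sequence of handle slides is an iteration of such operations. The direct sum of delta-matroids $(E,\mathcal{F})$, $(E',\mathcal{F}')$ with $E\cap E'=\emptyset$ is $(E\cup E',\{F\cup F': F\in\mathcal{F},F'\in\mathcal{F}'\})$. $D_{i,j,k}$ denotes the direct sum of $i$ copies of $(\{e\},\{\emptyset\})$, $j$ copies of $(\{e,f\},\{\emptyset,\{e,f\}\})$ and $k$ copies of $(\{e\},\{\emptyset,\{e\}\})$ (with disjoint ground sets, here identified with $E$). -}

module Defs where

open import Data.Bool using (Bool; true; false; _∧_; _xor_; not; _≟_)
open import Data.Nat using (ℕ; zero; suc; _+_; _*_; _%_)
open import Data.Fin using (Fin; zero; suc)
open import Data.Fin.Subset using (Subset; ⊥; ⁅_⁆; _∪_; _⊆_; _∈_; ∣_∣)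
open import Data.Vec using (Vec; lookup; tabulate; zipWith; take; drop; _[_]≔_)
open import Data.Product using (Σ; ∃; ∃-syntax; _×_; _,_)
open import Function.Bundles using (_↔_; Inverse)
open import Relation.Binary.PropositionalEquality using (_≡_; _≢_)
open import Relation.Binary.Construct.Closure.ReflexiveTransitive using (Star)

-- A set system on the ground set E = Fin n: a (decidable) family of subsets.
-- X is feasible iff F X ≡ true.
SetSystem : ℕ → Set
SetSystem n = Subset n → Bool

_△_ : ∀ {n} → Subset n → Subset n → Subset n
X △ Y = zipWith _xor_ X Y

IsDeltaMatroid : ∀ {n} → SetSystem n → Set
IsDeltaMatroid {n} F =
  (∃[ X ] F X ≡ true) ×
  (∀ (X Y : Subset n) (u : Fin n) → F X ≡ true → F Y ≡ true → u ∈ (X △ Y) →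
     ∃[ v ] (v ∈ (X △ Y) × F (X △ (⁅ u ⁆ ∪ ⁅ v ⁆)) ≡ true))

IsEven : ∀ {n} → SetSystem n → Set
IsEven {n} F = ∀ (X Y : Subset n) → F X ≡ true → F Y ≡ true → ∣ X ∣ % 2 ≡ ∣ Y ∣ % 2

twist : ∀ {n} → SetSystem n → Subset n → SetSystem n
twist F A Y = F (A △ Y)

relabel : ∀ {n m} → (Fin n → Fin m) → Subset m → Subset n
relabel f Y = tabulate (λ x → lookup Y (f x))

-- symmetric matrices over GF(2) = Bool (xor, ∧)
Matrix : ℕ → Set
Matrix n = Fin n → Fin n → Bool

IsSymmetric : ∀ {n} → Matrix n → Set
IsSymmetric M = ∀ i j → M i j ≡ M j i

xorSum : ∀ {n} → (Fin n → Bool) → Bool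
xorSum {zero} f = false
xorSum {suc n} f = f zero xor xorSum (λ i → f (suc i))

-- the principal submatrix M[A] is non-singular: the only vector x supported
-- on A with M[A] x = 0 is x = 0  (M[∅] is non-singular, vacuously)
NonSingularPrincipal : ∀ {n} → Matrix n → Subset n → Set
NonSingularPrincipal {n} M A =
  ∀ (x : Subset n) → x ⊆ A →
    (∀ i → i ∈ A → xorSum (λ j → M i j ∧ lookup x j) ≡ false) → x ≡ ⊥

-- D is binary: some twist of D is isomorphic to D(M), M symmetric over GF(2).
-- The isomorphism σ sends X to σ[X] = relabel (from σ) X.
IsBinary : ∀ {n} → SetSystem n → Set
IsBinary {n} F =
  Σ (Subset n) λ A → Σ (Matrix n) λ M → IsSymmetric M ×
  Σ (Fin n ↔ Fin n) λ σ → ∀ (X : Subset n) →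
    (twist F A X ≡ true → NonSingularPrincipal M (relabel (Inverse.from σ) X)) ×
    (NonSingularPrincipal M (relabel (Inverse.from σ) X) → twist F A X ≡ true)

-- handle slide of a over b:
-- F_ab = F △ { X ∪ {a} : X ∪ {b} ∈ F, X ⊆ E - {a,b} }
handleSlide : ∀ {n} → Fin n → Fin n → SetSystem n → SetSystem n
handleSlide a b F X =
  F X xor (lookup X a ∧ (not (lookup X b) ∧ F ((X [ a ]≔ false) [ b ]≔ true)))

-- one handle slide step (families compared extensionally)
HandleSlideStep : ∀ {n} → SetSystem n → SetSystem n → Set
HandleSlideStep {n} F G =
  Σ (Fin n) λ a → Σ (Fin n) λ b → a ≢ b × (∀ X → G X ≡ handleSlide a b F X)

HandleSlides : ∀ {n} → SetSystem n → SetSystem n → Set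
HandleSlides = Star HandleSlideStep

_⊕_ : ∀ {m n} → SetSystem m → SetSystem n → SetSystem (m + n)
_⊕_ {m} F G X = F (take m X) ∧ G (drop m X)

loopDM : SetSystem 1
loopDM X = not (lookup X zero)

pairDM : SetSystem 2
pairDM X = not (lookup X zero xor lookup X (suc zero))

freeDM : SetSystem 1
freeDM X = true

copies : ∀ {m} (k : ℕ) → SetSystem m → SetSystem (k * m)
copies zero F X = true
copies (suc k) F = F ⊕ copies k F

Dform : ∀ (i j k : ℕ) → SetSystem (i * 1 + (j * 2 + k * 1))
Dform i j k = copies i loopDM ⊕ (copies j pairDM ⊕ copies k freeDM)

Isomorphic : ∀ {n N} → SetSystem n → SetSystem N → Set
Isomorphic {n} {N} F G =
  Σ (Fin n ↔ Fin N) λ σ → ∀ (X : Subset n) → F X ≡ G (relabel (Inverse.from σ) X)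

TakesTo : ∀ {n} → SetSystem n → ℕ → ℕ → ℕ → Set
TakesTo F i j k = ∃[ G ] (HandleSlides F G × Isomorphic G (Dform i j k))

-- A binary set system D with ∅ feasible is D(N) for a symmetric matrix N over GF(2): a twist D(M) * A by
-- a feasible set A is D of the principal pivot transform of M at A.  Over GF(2) non-singularity of a
-- principal submatrix is additive in each row and column, so the handle slide of a over b on D(N) is
-- D(N′), where N′ adds row and column b of N to row and column a.  These slides and relabellings carry
-- out a symmetric Gaussian elimination that splits off one element at a time: a zero row gives a loop
-- ({e},{∅}), a nonzero diagonal entry a free element ({e},{∅,{e}}), and a nonzero off-diagonal entry
-- between two zero diagonal entries a pair ({e,f},{∅,{e,f}}); three more slides turn a free element and a
-- pair into three free elements.  Handle slides and isomorphisms preserve which sizes of feasible sets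
-- occur.  In D_{i,j,k} the largest size is 2j + k, size 1 occurs iff k ≠ 0 and all sizes are even
-- otherwise, so with |E| = i + 2j + k these sizes determine i, and determine j and k when j = 0 or k = 0.

module Submission where

open import Defs
open import Algebra.Bundles using (CommutativeRing; CommutativeMonoid)
import Algebra.Properties.CommutativeMonoid.Sum as CommutativeMonoidSum
import Algebra.Properties.Semiring.Sum as SemiringSum
open import Data.Bool using (Bool; true; false; _∧_; _xor_; not; if_then_else_)
open import Data.Bool.Properties
  using (xor-same; xor-assoc; xor-comm; xor-identityʳ; ∧-comm; ∧-assoc; ∧-zeroʳ; ∧-identityʳ; ∧-distribˡ-xor;
         ∧-distribʳ-xor; ∧-conicalˡ; ∧-conicalʳ; ∧-commutativeMonoid; xor-∧-commutativeRing; ¬-not; not-involutive)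
  renaming (_≟_ to _≟ᵇ_)
open import Data.Empty using (⊥-elim)
open import Data.Fin using (Fin; zero; suc; _↑ʳ_; _↑ˡ_)
open import Data.Fin.Properties using (_≟_; all?; any?; suc-injective; ↑ʳ-injective; ↑ˡ-injective)
open import Data.Fin.Permutation
  using (Permutation; Permutation′; _⟨$⟩ʳ_; _⟨$⟩ˡ_; inverseˡ; inverseʳ; flip; _∘ₚ_; permutation; transpose; ↔⇒≡)
  renaming (id to idₚ)
import Data.Fin.Permutation.Components as PC
open import Data.Fin.Subset using (Subset; ⊥; ∣_∣)
open import Data.Fin.Subset.Properties using (anySubset?; ∣p∣≤n)
open import Data.List using (List; []; _∷_; length; map; allFin)
open import Data.List.Properties using (length-map)
import Data.List.Relation.Unary.All as All
open All using (All; []; _∷_)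
import Data.List.Relation.Unary.All.Properties as Allₚ
open import Data.List.Membership.Propositional using (_∈_)
open import Data.List.Membership.Propositional.Properties using (∈-allFin)
open import Data.List.Relation.Unary.Any using (here; there)
open import Data.List.Relation.Binary.Permutation.Propositional using (_↭_; ↭-refl; ↭-prep; ↭-swap; ↭-trans; ↭-sym)
open import Data.List.Relation.Binary.Permutation.Propositional.Properties using (All-resp-↭; ↭-length)
open import Data.Nat using (ℕ; zero; suc; _+_; _*_; _%_; _<_; _≤_; s<s⁻¹; pred)
open import Data.Nat.Properties
  using (n<1+n; +-suc; ≤-reflexive; +-0-commutativeMonoid; *-zeroʳ; n≤0⇒n≡0; +-identityʳ; ≤-antisym; +-cancelʳ-≡;
         *-cancelʳ-≡; *-identityʳ)
open import Data.Nat.DivMod using (%-distribˡ-+)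
open import Data.Product using (Σ-syntax; ∃; ∃₂; ∃-syntax; _×_; _,_; proj₁; proj₂; uncurry)
open import Data.Sum using (_⊎_; inj₁; inj₂; [_,_])
open import Data.Vec using (Vec; []; _∷_; lookup; tabulate; _[_]≔_; _++_; take; drop)
open import Data.Vec.Properties
  using (lookup∘tabulate; lookup∘update; lookup∘update′; lookup-zipWith; lookup-replicate; tabulate∘lookup;
         tabulate-cong; []=⇒lookup; lookup⇒[]=; take++drop≡id; ++-injective; []≔-++-↑ˡ; lookup-++ˡ)
open import Data.Vec.Functional using (Vector; tail) renaming (_∷_ to _◂_)
open import Function using (id; _∘_)
open import Function.Bundles using (_⇔_; mk⇔; Equivalence; Injection)
open import Function.Properties.Inverse using (↔⇒↣)
open import Function.Construct.Identity using (⇔-id)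
open import Function.Construct.Composition using (_⇔-∘_)
open import Relation.Nullary using (Dec; yes; no; ¬_; does; proof; Reflects; invert)
open import Relation.Nullary.Decidable
  using (dec-true; dec-false; does-⇔; decidable-stable; ¬?; _→-dec_; _×-dec_; _⊎-dec_)
open import Relation.Binary.PropositionalEquality
  using (_≡_; _≢_; _≗_; refl; sym; trans; cong; cong₂; subst; module ≡-Reasoning)
open import Relation.Binary.Construct.Closure.ReflexiveTransitive using (ε; _◅_; _◅◅_; gmap)

module 𝔽₂ = CommutativeRing xor-∧-commutativeRing
open CommutativeMonoidSum 𝔽₂.+-commutativeMonoid
  using (sum; sum-cong-≗; sum-replicate-zero; ∑-distrib-+; ∑-comm; sum-permute)
open CommutativeMonoidSum +-0-commutativeMonoid
  using () renaming (sum to sumℕ; sum-permute to sumℕ-permute; sum-cong-≗ to sumℕ-cong-≗)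
open SemiringSum 𝔽₂.semiring using (*-distribˡ-sum; *-distribʳ-sum)
open import Algebra.Properties.CommutativeSemigroup 𝔽₂.+-commutativeSemigroup using (interchange)
open import Algebra.Properties.CommutativeSemigroup (CommutativeMonoid.commutativeSemigroup ∧-commutativeMonoid)
  using () renaming (x∙yz≈y∙xz to ∧-swapˡ)

true≢false : true ≢ false
true≢false ()

xor≡false⇒≡ : ∀ {x y} → x xor y ≡ false → x ≡ y
xor≡false⇒≡ {true} {true} _ = refl
xor≡false⇒≡ {false} {false} _ = refl

xor≡true : ∀ {p q} → p xor q ≡ true → (p ≡ true × q ≡ false) ⊎ (p ≡ false × q ≡ true)
xor≡true {true}  {false} _ = inj₁ (refl , refl)
xor≡true {false} {true}  _ = inj₂ (refl , refl)

does-≟ᵇ-true : ∀ b → does (b ≟ᵇ true) ≡ b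
does-≟ᵇ-true true  = refl
does-≟ᵇ-true false = refl

xor-cancelʳ : ∀ p e → p xor (e xor p) ≡ e
xor-cancelʳ p e = trans (cong (p xor_) (xor-comm e p)) (trans (sym (xor-assoc p p e)) (cong (_xor e) (xor-same p)))

xor-cancel-middle : ∀ p y z → (p xor y) xor (y xor z) ≡ p xor z
xor-cancel-middle p y z = begin
  (p xor y) xor (y xor z)  ≡⟨ xor-assoc p y (y xor z) ⟩
  p xor (y xor (y xor z))  ≡⟨ cong (p xor_) (sym (xor-assoc y y z)) ⟩
  p xor ((y xor y) xor z)  ≡⟨ cong (λ t → p xor (t xor z)) (xor-same y) ⟩
  p xor z                  ∎
  where open ≡-Reasoning

∧-factorˡ : ∀ h p q r s → h ∧ p xor q ∧ (r ∧ (h ∧ s)) ≡ h ∧ (p xor q ∧ (r ∧ s))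
∧-factorˡ true  p q r s = refl
∧-factorˡ false p q r s = trans (cong (q ∧_) (∧-zeroʳ r)) (∧-zeroʳ q)

∧-factorʳ : ∀ g h p q s → g ∧ h xor p ∧ (q ∧ (s ∧ h)) ≡ (g xor p ∧ (q ∧ s)) ∧ h
∧-factorʳ g h p q s = begin
  g ∧ h xor p ∧ (q ∧ (s ∧ h))    ≡⟨ cong (λ t → g ∧ h xor p ∧ t) (sym (∧-assoc q s h)) ⟩
  g ∧ h xor p ∧ ((q ∧ s) ∧ h)    ≡⟨ cong (g ∧ h xor_) (sym (∧-assoc p (q ∧ s) h)) ⟩
  g ∧ h xor (p ∧ (q ∧ s)) ∧ h    ≡⟨ sym (∧-distribʳ-xor h g (p ∧ (q ∧ s))) ⟩
  (g xor p ∧ (q ∧ s)) ∧ h        ∎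
  where open ≡-Reasoning

∧³-true : ∀ {p q r} → p ∧ (not q ∧ r) ≡ true → p ≡ true × q ≡ false × r ≡ true
∧³-true {true} {false} {true} _ = refl , refl , refl

rowColumn-commute : ∀ p q x y z w →
  (x xor p ∧ y) xor q ∧ (z xor p ∧ w) ≡ (x xor q ∧ z) xor p ∧ (y xor q ∧ w)
rowColumn-commute false false x y z w = refl
rowColumn-commute true  false x y z w rewrite xor-identityʳ x | xor-identityʳ y = xor-identityʳ (x xor y)
rowColumn-commute false true  x y z w rewrite xor-identityʳ x | xor-identityʳ z = sym (xor-identityʳ (x xor z))
rowColumn-commute true  true  x y z w = interchange x y z w

sum-zero : ∀ {n} {f : Vector Bool n} → (∀ i → f i ≡ false) → sum f ≡ false
sum-zero {n} f≡0 = trans (sum-cong-≗ f≡0) (sum-replicate-zero n)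

δ : ∀ {n} → Fin n → Fin n → Bool
δ zero    zero    = true
δ zero    (suc j) = false
δ (suc i) zero    = false
δ (suc i) (suc j) = δ i j

δ-diag : ∀ {n} (i : Fin n) → δ i i ≡ true
δ-diag zero    = refl
δ-diag (suc i) = δ-diag i

δ-off : ∀ {n} {i j : Fin n} → i ≢ j → δ i j ≡ false
δ-off {i = zero}  {zero}  i≢j = ⊥-elim (i≢j refl)
δ-off {i = zero}  {suc j} _   = refl
δ-off {i = suc i} {zero}  _   = refl
δ-off {i = suc i} {suc j} i≢j = δ-off (i≢j ∘ cong suc)

δ-comm : ∀ {n} (i j : Fin n) → δ i j ≡ δ j i
δ-comm zero    zero    = refl
δ-comm zero    (suc j) = refl
δ-comm (suc i) zero    = refl
δ-comm (suc i) (suc j) = δ-comm i j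

sum-δ : ∀ {n} (f : Vector Bool n) j → sum (λ i → f i ∧ δ i j) ≡ f j
sum-δ f zero =
  trans (cong₂ _xor_ (∧-identityʳ (f zero)) (sum-zero (λ i → ∧-zeroʳ (f (suc i))))) (xor-identityʳ (f zero))
sum-δ f (suc j) = trans (cong (_xor sum (λ i → f (suc i) ∧ δ i j)) (∧-zeroʳ (f zero))) (sum-δ (tail f) j)

sum-δˡ : ∀ {n} (f : Vector Bool n) k → sum (λ j → δ k j ∧ f j) ≡ f k
sum-δˡ f k = trans (sum-cong-≗ (λ j → trans (∧-comm (δ k j) (f j)) (cong (f j ∧_) (δ-comm k j)))) (sum-δ f k)

infixl 7 _·_
infixl 6 _+ᵛ_

_·_ : ∀ {n} → Vector Bool n → Vector Bool n → Bool
u · v = sum (λ j → u j ∧ v j)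

_+ᵛ_ : ∀ {n} → Vector Bool n → Vector Bool n → Vector Bool n
(u +ᵛ v) j = u j xor v j

·-congʳ : ∀ {n} (u : Vector Bool n) {x y} → x ≗ y → u · x ≡ u · y
·-congʳ u x≗y = sum-cong-≗ (λ j → cong (u j ∧_) (x≗y j))

·-congˡ : ∀ {n} {u v : Vector Bool n} x → u ≗ v → u · x ≡ v · x
·-congˡ x u≗v = sum-cong-≗ (λ j → cong (_∧ x j) (u≗v j))

·-comm : ∀ {n} (u v : Vector Bool n) → u · v ≡ v · u
·-comm u v = sum-cong-≗ (λ j → ∧-comm (u j) (v j))

·-distribˡ-+ᵛ : ∀ {n} (u x y : Vector Bool n) → u · (x +ᵛ y) ≡ u · x xor u · y
·-distribˡ-+ᵛ u x y =
  trans (sum-cong-≗ (λ j → ∧-distribˡ-xor (u j) (x j) (y j))) (∑-distrib-+ (λ j → u j ∧ x j) (λ j → u j ∧ y j))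

·-distribʳ-+ᵛ : ∀ {n} (u v x : Vector Bool n) → (u +ᵛ v) · x ≡ u · x xor v · x
·-distribʳ-+ᵛ u v x =
  trans (sum-cong-≗ (λ j → ∧-distribʳ-xor (x j) (u j) (v j))) (∑-distrib-+ (λ j → u j ∧ x j) (λ j → v j ∧ x j))

·-zeroʳ : ∀ {n} (u : Vector Bool n) {x} → (∀ j → x j ≡ false) → u · x ≡ false
·-zeroʳ u x≡0 = sum-zero (λ j → trans (cong (u j ∧_) (x≡0 j)) (∧-zeroʳ (u j)))

infix 4 _⊆ᵛ_

_⊆ᵛ_ : ∀ {n} → Vector Bool n → Vector Bool n → Set
x ⊆ᵛ S = ∀ i → x i ≡ true → S i ≡ true

IsZero : ∀ {n} → Vector Bool n → Set
IsZero x = ∀ i → x i ≡ false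

+ᵛ-⊆ᵛ : ∀ {n} {x y S : Vector Bool n} → x ⊆ᵛ S → y ⊆ᵛ S → (x +ᵛ y) ⊆ᵛ S
+ᵛ-⊆ᵛ {x = x} x⊆S y⊆S i with x i in xi
... | true  = λ _ → x⊆S i xi
... | false = y⊆S i

·-cong-on : ∀ {n} {u v : Vector Bool n} {x S} → x ⊆ᵛ S → (∀ j → S j ≡ true → u j ≡ v j) → u · x ≡ v · x
·-cong-on {u = u} {v} {x} x⊆S u≡v = sum-cong-≗ pointwise
  where
  pointwise : ∀ j → (u j ∧ x j) ≡ (v j ∧ x j)
  pointwise j with x j in xj
  ... | true  = cong (_∧ true) (u≡v j (x⊆S j xj))
  ... | false = trans (∧-zeroʳ (u j)) (sym (∧-zeroʳ (v j)))

infixl 8 _*ᵛ_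
infix 9 _ᵀ

_*ᵛ_ : ∀ {n} → Matrix n → Vector Bool n → Vector Bool n
(M *ᵛ x) i = M i · x

_ᵀ : ∀ {n} → Matrix n → Matrix n
(M ᵀ) i j = M j i

·-*ᵛ-transpose : ∀ {n} (y : Vector Bool n) M x → y · (M *ᵛ x) ≡ (M ᵀ *ᵛ y) · x
·-*ᵛ-transpose y M x = begin
  sum (λ i → y i ∧ sum (λ j → M i j ∧ x j))
    ≡⟨ sum-cong-≗ (λ i → *-distribˡ-sum (y i) (λ j → M i j ∧ x j)) ⟩
  sum (λ i → sum (λ j → y i ∧ (M i j ∧ x j)))
    ≡⟨ ∑-comm (λ i j → y i ∧ (M i j ∧ x j)) ⟩
  sum (λ j → sum (λ i → y i ∧ (M i j ∧ x j)))
    ≡⟨ sum-cong-≗ (λ j → sum-cong-≗ (λ i → rearrange (y i) (M i j) (x j))) ⟩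
  sum (λ j → sum (λ i → (M i j ∧ y i) ∧ x j))
    ≡⟨ sum-cong-≗ (λ j → sym (*-distribʳ-sum (x j) (λ i → M i j ∧ y i))) ⟩
  sum (λ j → sum (λ i → M i j ∧ y i) ∧ x j) ∎
  where
  open ≡-Reasoning
  rearrange : ∀ a b c → a ∧ (b ∧ c) ≡ (b ∧ a) ∧ c
  rearrange a b c = trans (sym (∧-assoc a b c)) (cong (_∧ c) (∧-comm a b))

weight : ∀ {n} → Vector Bool n → ℕ
weight {zero} S = 0
weight {suc n} S = (if S zero then 1 else 0) + weight (tail S)

NontrivialSolution : ∀ {n} → List (Vector Bool n) → Vector Bool n → Set
NontrivialSolution {n} rows S =
  Σ[ x ∈ Vector Bool n ] x ⊆ᵛ S × (∃ λ i → x i ≡ true) × All (λ r → r · x ≡ false) rows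

pivotRow : ∀ {n} (rows : List (Vector Bool (suc n))) →
  All (λ r → r zero ≡ false) rows ⊎ ∃₂ λ r rest → r zero ≡ true × rows ↭ r ∷ rest
pivotRow [] = inj₁ []
pivotRow (r ∷ rows) with r zero in r₀ | pivotRow rows
... | true  | _ = inj₂ (r , rows , r₀ , ↭-refl)
... | false | inj₁ r₀s = inj₁ (r₀ ∷ r₀s)
... | false | inj₂ (p , rest , p₀ , rows↭) =
  inj₂ (p , r ∷ rest , p₀ , ↭-trans (↭-prep r rows↭) (↭-swap r p ↭-refl))

solution-prependFalse : ∀ {n} rows (S : Vector Bool (suc n)) →
  NontrivialSolution (map tail rows) (tail S) → NontrivialSolution rows S
solution-prependFalse rows S (x , x⊆S , (i , xi) , solves) =
  false ◂ x , ⊆S , (suc i , xi) , All.map (λ {r} → solves′ {r}) (Allₚ.map⁻ {P = λ r → r · x ≡ false} solves)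
  where
  ⊆S : (false ◂ x) ⊆ᵛ S
  ⊆S (suc i) xi = x⊆S i xi
  solves′ : ∀ {r} → tail r · x ≡ false → r · (false ◂ x) ≡ false
  solves′ {r} = trans (cong (_xor tail r · x) (∧-zeroʳ (r zero)))

solution-unit : ∀ {n} rows (S : Vector Bool (suc n)) → S zero ≡ true →
  All (λ r → r zero ≡ false) rows → NontrivialSolution rows S
solution-unit rows S S₀ r₀s = e₀ , ⊆S , (zero , refl) , All.map (λ {r} → solves {r}) r₀s
  where
  e₀ : Vector Bool _
  e₀ = true ◂ λ _ → false
  ⊆S : e₀ ⊆ᵛ S
  ⊆S zero _ = S₀
  solves : ∀ {r} → r zero ≡ false → r · e₀ ≡ false
  solves {r} r₀ = cong₂ _xor_ (trans (∧-identityʳ (r zero)) r₀) (·-zeroʳ (tail r) (λ _ → refl))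

eliminate : ∀ {n} → Vector Bool (suc n) → Vector Bool (suc n) → Vector Bool n
eliminate r ρ j = ρ (suc j) xor (ρ zero ∧ r (suc j))

·-eliminate : ∀ {n} (r ρ : Vector Bool (suc n)) x →
  eliminate r ρ · x ≡ tail ρ · x xor (ρ zero ∧ tail r · x)
·-eliminate r ρ x = begin
  eliminate r ρ · x
    ≡⟨ sum-cong-≗ (λ j → trans (∧-distribʳ-xor (x j) (ρ (suc j)) (ρ zero ∧ r (suc j)))
                                (cong (ρ (suc j) ∧ x j xor_) (∧-assoc (ρ zero) (r (suc j)) (x j)))) ⟩
  sum (λ j → ρ (suc j) ∧ x j xor ρ zero ∧ (r (suc j) ∧ x j))
    ≡⟨ ∑-distrib-+ (λ j → ρ (suc j) ∧ x j) (λ j → ρ zero ∧ (r (suc j) ∧ x j)) ⟩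
  tail ρ · x xor sum (λ j → ρ zero ∧ (r (suc j) ∧ x j))
    ≡⟨ cong (tail ρ · x xor_) (sym (*-distribˡ-sum (ρ zero) (λ j → r (suc j) ∧ x j))) ⟩
  tail ρ · x xor (ρ zero ∧ tail r · x) ∎
  where open ≡-Reasoning

-- Gaussian elimination: the pivot row fixes the first coordinate in terms of the others.
solution-backSubstitute : ∀ {n} r rest (S : Vector Bool (suc n)) → r zero ≡ true → S zero ≡ true →
  NontrivialSolution (map (eliminate r) rest) (tail S) → NontrivialSolution (r ∷ rest) S
solution-backSubstitute r rest S r₀ S₀ (x , x⊆S , (i , xi) , solves) =
  d ◂ x , ⊆S , (suc i , xi) ,
  solvesPivot ∷ All.map (λ {ρ} → solvesRow {ρ}) (Allₚ.map⁻ {P = λ ρ → ρ · x ≡ false} solves)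
  where
  d = tail r · x
  ⊆S : (d ◂ x) ⊆ᵛ S
  ⊆S zero _ = S₀
  ⊆S (suc i) xi = x⊆S i xi
  solvesPivot : r · (d ◂ x) ≡ false
  solvesPivot = trans (cong (λ b → b ∧ d xor d) r₀) (xor-same d)
  solvesRow : ∀ {ρ} → eliminate r ρ · x ≡ false → ρ · (d ◂ x) ≡ false
  solvesRow {ρ} e = trans (xor-comm (ρ zero ∧ d) (tail ρ · x)) (trans (sym (·-eliminate r ρ x)) e)

underdetermined : ∀ {n} (rows : List (Vector Bool n)) (S : Vector Bool n) →
  length rows < weight S → NontrivialSolution rows S
underdetermined {suc n} rows S lt with S zero in S₀
... | false = solution-prependFalse rows S
                (underdetermined (map tail rows) (tail S) (subst (_< weight (tail S)) (sym (length-map tail rows)) lt))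
... | true with pivotRow rows
...   | inj₁ r₀s = solution-unit rows S S₀ r₀s
...   | inj₂ (r , rest , r₀ , rows↭) =
  let x , x⊆S , nz , solves = solution-backSubstitute r rest S r₀ S₀ (underdetermined _ (tail S) lt′)
  in x , x⊆S , nz , All-resp-↭ (↭-sym rows↭) solves
  where
  lt′ : length (map (eliminate r) rest) < weight (tail S)
  lt′ = subst (_< weight (tail S)) (sym (length-map (eliminate r) rest))
          (s<s⁻¹ (subst (_< suc (weight (tail S))) (↭-length rows↭) lt))

-- Non-singular principal submatrices

InKernel : ∀ {n} → Matrix n → Vector Bool n → Vector Bool n → Set
InKernel M S x = ∀ i → S i ≡ true → M i · x ≡ false

NonSingular : ∀ {n} → Matrix n → Vector Bool n → Set
NonSingular M S = ∀ x → x ⊆ᵛ S → InKernel M S x → IsZero x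

support : ∀ {n} → Vector Bool n → List (Fin n)
support {zero} S = []
support {suc n} S = (if S zero then zero ∷_ else id) (map suc (support (tail S)))

length-support : ∀ {n} (S : Vector Bool n) → length (support S) ≡ weight S
length-support {zero} S = refl
length-support {suc n} S with S zero
... | true  = cong suc (trans (length-map suc (support (tail S))) (length-support (tail S)))
... | false = trans (length-map suc (support (tail S))) (length-support (tail S))

All-support : ∀ {n} {P : Fin n → Set} (S : Vector Bool n) → All P (support S) → ∀ i → S i ≡ true → P i
All-support {suc n} {P} S Ps i Si with S zero in S₀
All-support {suc n} {P} S (P₀ ∷ Ps) zero    Si | true  = P₀
All-support {suc n} {P} S (P₀ ∷ Ps) (suc i) Si | true  = All-support {P = P ∘ suc} (tail S) (Allₚ.map⁻ Ps) i Si
All-support {suc n} {P} S Ps        zero    Si | false = ⊥-elim (true≢false (trans (sym Si) S₀))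
All-support {suc n} {P} S Ps        (suc i) Si | false = All-support {P = P ∘ suc} (tail S) (Allₚ.map⁻ Ps) i Si

-- Solve M[S] x = c[S] through the homogeneous system (c | M) in the unknowns (t, x):
-- a nonzero solution must have t = 1, since t = 0 would put x in the kernel.
nonSingular⇒solvable : ∀ {n} {M : Matrix n} {S} → NonSingular M S → (c : Vector Bool n) →
  Σ[ x ∈ Vector Bool n ] x ⊆ᵛ S × (∀ i → S i ≡ true → M i · x ≡ c i)
nonSingular⇒solvable {n} {M} {S} nonSing c = finish (x̂ zero) refl
  where
  rows = map (λ i → c i ◂ M i) (support S)
  fewer : length rows < weight (true ◂ S)
  fewer = subst (_< suc (weight S)) (sym (trans (length-map _ (support S)) (length-support S))) (n<1+n _)
  homogeneous = underdetermined rows (true ◂ S) fewer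
  x̂ = proj₁ homogeneous
  x̂⊆ = proj₁ (proj₂ homogeneous)
  x̂≢0 = proj₁ (proj₂ (proj₂ homogeneous))
  equation : ∀ i → S i ≡ true → M i · tail x̂ ≡ c i ∧ x̂ zero
  equation i Si = sym (xor≡false⇒≡ (All-support {P = λ i → (c i ◂ M i) · x̂ ≡ false} S
                    (Allₚ.map⁻ (proj₂ (proj₂ (proj₂ homogeneous)))) i Si))
  finish : ∀ t → x̂ zero ≡ t → Σ[ x ∈ Vector Bool n ] x ⊆ᵛ S × (∀ i → S i ≡ true → M i · x ≡ c i)
  finish true x̂₀ =
    tail x̂ , (λ i → x̂⊆ (suc i)) , λ i Si → trans (equation i Si) (trans (cong (c i ∧_) x̂₀) (∧-identityʳ (c i)))
  finish false x̂₀ = ⊥-elim (true≢false (trans (sym (proj₂ x̂≢0)) (x̂≡0 (proj₁ x̂≢0))))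
    where
    tail≡0 : IsZero (tail x̂)
    tail≡0 = nonSing (tail x̂) (λ i → x̂⊆ (suc i))
               (λ i Si → trans (equation i Si) (trans (cong (c i ∧_) x̂₀) (∧-zeroʳ (c i))))
    x̂≡0 : IsZero x̂
    x̂≡0 zero = x̂₀
    x̂≡0 (suc i) = tail≡0 i

nonSingular-transpose : ∀ {n} {M : Matrix n} {S} → NonSingular M S → NonSingular (M ᵀ) S
nonSingular-transpose {M = M} {S} nonSing y y⊆S Mᵀy≡0 k with S k in Sk
... | false = ¬-not (λ yk → true≢false (trans (sym (y⊆S k yk)) Sk))
... | true = begin
  y k                            ≡⟨ sym (sum-δ y k) ⟩
  y · (λ i → δ i k)              ≡⟨ ·-comm y _ ⟩
  (λ i → δ i k) · y              ≡⟨ ·-cong-on y⊆S (λ i Si → sym (proj₂ (proj₂ solution) i Si)) ⟩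
  (M *ᵛ x) · y                   ≡⟨ ·-comm (M *ᵛ x) y ⟩
  y · (M *ᵛ x)                   ≡⟨ ·-*ᵛ-transpose y M x ⟩
  (M ᵀ *ᵛ y) · x                 ≡⟨ ·-cong-on {u = M ᵀ *ᵛ y} {v = λ _ → false} x⊆S Mᵀy≡0 ⟩
  (λ _ → false) · x              ≡⟨ sum-zero {f = λ j → false ∧ x j} (λ _ → refl) ⟩
  false ∎
  where
  open ≡-Reasoning
  solution = nonSingular⇒solvable nonSing (λ i → δ i k)
  x = proj₁ solution
  x⊆S = proj₁ (proj₂ solution)

nonSingular-cong : ∀ {n} {M M′ : Matrix n} {S} → (∀ i j → S i ≡ true → S j ≡ true → M i j ≡ M′ i j) →
  NonSingular M S → NonSingular M′ S
nonSingular-cong M≡M′ nonSing x x⊆S kernel =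
  nonSing x x⊆S (λ i Si → trans (·-cong-on x⊆S (λ j Sj → M≡M′ i j Si Sj)) (kernel i Si))

nonSingular-resp-≗ : ∀ {n} {M : Matrix n} {S S′} → S ≗ S′ → NonSingular M S → NonSingular M S′
nonSingular-resp-≗ S≗S′ nonSing x x⊆S′ kernel =
  nonSing x (λ i xi → trans (S≗S′ i) (x⊆S′ i xi)) (λ i Si → kernel i (trans (sym (S≗S′ i)) Si))

∀-Vector? : ∀ {n} {P : Vector Bool n → Set} → (∀ {x y} → x ≗ y → P x → P y) →
  (∀ x → Dec (P x)) → Dec (∀ x → P x)
∀-Vector? {P = P} resp P? with anySubset? (λ X → ¬? (P? (lookup X)))
... | yes (X , ¬PX) = no (λ ∀P → ¬PX (∀P (lookup X)))
... | no ∄ = yes (λ x → decidable-stable (P? x)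
                   (λ ¬Px → ∄ (tabulate x , λ PX → ¬Px (resp (lookup∘tabulate x) PX))))

⊆ᵛ? : ∀ {n} (x S : Vector Bool n) → Dec (x ⊆ᵛ S)
⊆ᵛ? x S = all? (λ i → (x i ≟ᵇ true) →-dec (S i ≟ᵇ true))

isZero? : ∀ {n} (x : Vector Bool n) → Dec (IsZero x)
isZero? x = all? (λ i → x i ≟ᵇ false)

inKernel? : ∀ {n} (M : Matrix n) S x → Dec (InKernel M S x)
inKernel? M S x = all? (λ i → (S i ≟ᵇ true) →-dec (M i · x ≟ᵇ false))

nonSingular? : ∀ {n} (M : Matrix n) S → Dec (NonSingular M S)
nonSingular? M S = ∀-Vector? resp (λ x → ⊆ᵛ? x S →-dec (inKernel? M S x →-dec isZero? x))
  where
  resp : ∀ {x y} → x ≗ y → (x ⊆ᵛ S → InKernel M S x → IsZero x) → y ⊆ᵛ S → InKernel M S y → IsZero y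
  resp x≗y Px y⊆S kernel i =
    trans (sym (x≗y i)) (Px (λ j xj → y⊆S j (trans (sym (x≗y j)) xj))
                            (λ j Sj → trans (·-congʳ (M j) x≗y) (kernel j Sj)) i)

-- Opaque so that the brute-force decision procedure is never unfolded during type checking.
opaque
  isNonSingular : ∀ {n} → Matrix n → Vector Bool n → Bool
  isNonSingular M S = does (nonSingular? M S)

  isNonSingular-does : ∀ {n} {M : Matrix n} {S} {P : Set} →
    NonSingular M S ⇔ P → (P? : Dec P) → isNonSingular M S ≡ does P?
  isNonSingular-does {M = M} {S} eq = does-⇔ eq (nonSingular? M S)

  isNonSingular-true⁻¹ : ∀ {n} {M : Matrix n} {S} → isNonSingular M S ≡ true → NonSingular M S
  isNonSingular-true⁻¹ {M = M} {S} e = invert (subst (Reflects (NonSingular M S)) e (proof (nonSingular? M S)))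

D[_] : ∀ {n} → Matrix n → SetSystem n
D[ M ] X = isNonSingular M (lookup X)

isNonSingular-⇔ : ∀ {n n′} {M : Matrix n} {M′ : Matrix n′} {S S′} →
  NonSingular M S ⇔ NonSingular M′ S′ → isNonSingular M S ≡ isNonSingular M′ S′
isNonSingular-⇔ {M = M} {M′} {S} {S′} eq =
  trans (isNonSingular-does eq (nonSingular? M′ S′)) (sym (isNonSingular-does (mk⇔ id id) (nonSingular? M′ S′)))

isNonSingular-true : ∀ {n} {M : Matrix n} {S} → NonSingular M S → isNonSingular M S ≡ true
isNonSingular-true {M = M} {S} ns =
  trans (isNonSingular-does (mk⇔ id id) (nonSingular? M S)) (dec-true (nonSingular? M S) ns)

isNonSingular-false : ∀ {n} {M : Matrix n} {S} → ¬ NonSingular M S → isNonSingular M S ≡ false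
isNonSingular-false {M = M} {S} ¬ns =
  trans (isNonSingular-does (mk⇔ id id) (nonSingular? M S)) (dec-false (nonSingular? M S) ¬ns)

isNonSingular-transpose : ∀ {n} (M : Matrix n) S → isNonSingular M S ≡ isNonSingular (M ᵀ) S
isNonSingular-transpose M S = isNonSingular-⇔ (mk⇔ nonSingular-transpose (nonSingular-transpose {M = M ᵀ}))

isNonSingular-cong : ∀ {n} {M M′ : Matrix n} {S} → (∀ i j → S i ≡ true → S j ≡ true → M i j ≡ M′ i j) →
  isNonSingular M S ≡ isNonSingular M′ S
isNonSingular-cong M≡M′ =
  isNonSingular-⇔ (mk⇔ (nonSingular-cong M≡M′) (nonSingular-cong (λ i j Si Sj → sym (M≡M′ i j Si Sj))))

isNonSingular-resp-≗ : ∀ {n} (M : Matrix n) {S S′} → S ≗ S′ → isNonSingular M S ≡ isNonSingular M S′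
isNonSingular-resp-≗ M S≗S′ =
  isNonSingular-⇔ (mk⇔ (nonSingular-resp-≗ S≗S′) (nonSingular-resp-≗ (λ i → sym (S≗S′ i))))

_⟨_⟩ₘ : ∀ {n} → Matrix n → Permutation′ n → Matrix n
(M ⟨ π ⟩ₘ) i j = M (π ⟨$⟩ʳ i) (π ⟨$⟩ʳ j)

nonSingular-permute : ∀ {n} {M : Matrix n} {S} (π : Permutation′ n) →
  NonSingular M S → NonSingular (M ⟨ π ⟩ₘ) (S ∘ (π ⟨$⟩ʳ_))
nonSingular-permute {M = M} {S} π nonSing x x⊆ kernel i =
  trans (cong x (sym (inverseˡ π))) (x̂≡0 (π ⟨$⟩ʳ i))
  where
  x̂ : Vector Bool _
  x̂ k = x (π ⟨$⟩ˡ k)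
  S[π⁻¹k] : ∀ {k} → S k ≡ true → S (π ⟨$⟩ʳ (π ⟨$⟩ˡ k)) ≡ true
  S[π⁻¹k] = subst (λ z → S z ≡ true) (sym (inverseʳ π))
  x̂∈ker : InKernel M S x̂
  x̂∈ker k Sk = begin
    M k · x̂                                          ≡⟨ sum-permute (λ j → M k j ∧ x̂ j) π ⟩
    sum (λ j → M k (π ⟨$⟩ʳ j) ∧ x (π ⟨$⟩ˡ (π ⟨$⟩ʳ j)))
      ≡⟨ sum-cong-≗ (λ j → cong₂ (λ u v → M u (π ⟨$⟩ʳ j) ∧ x v) (sym (inverseʳ π)) (inverseˡ π)) ⟩
    (M ⟨ π ⟩ₘ) (π ⟨$⟩ˡ k) · x                        ≡⟨ kernel (π ⟨$⟩ˡ k) (S[π⁻¹k] Sk) ⟩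
    false ∎
    where open ≡-Reasoning
  x̂≡0 : IsZero x̂
  x̂≡0 = nonSing x̂ (λ k x̂k → subst (λ z → S z ≡ true) (inverseʳ π) (x⊆ (π ⟨$⟩ˡ k) x̂k)) x̂∈ker

isNonSingular-permute : ∀ {n} (M : Matrix n) S (π : Permutation′ n) →
  isNonSingular M S ≡ isNonSingular (M ⟨ π ⟩ₘ) (S ∘ (π ⟨$⟩ʳ_))
isNonSingular-permute M S π = isNonSingular-⇔ (mk⇔ (nonSingular-permute π) undo)
  where
  undo : NonSingular (M ⟨ π ⟩ₘ) (S ∘ (π ⟨$⟩ʳ_)) → NonSingular M S
  undo = nonSingular-resp-≗ (λ i → cong S (inverseʳ π))
       ∘ nonSingular-cong (λ i j _ _ → cong₂ M (inverseʳ π) (inverseʳ π))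
       ∘ nonSingular-permute (flip π)

repeatedColumn⇒singular : ∀ {n} {M : Matrix n} {S a b} → S a ≡ true → S b ≡ true → a ≢ b →
  (∀ i → S i ≡ true → M i a ≡ M i b) → ¬ NonSingular M S
repeatedColumn⇒singular {M = M} {S} {a} {b} Sa Sb a≢b Ma≡Mb nonSing =
  true≢false (trans (sym xa) (nonSing x x⊆S x∈ker a))
  where
  x : Vector Bool _
  x k = δ k a xor δ k b
  xa : x a ≡ true
  xa = cong₂ _xor_ (δ-diag a) (δ-off a≢b)
  x⊆S : x ⊆ᵛ S
  x⊆S k xk with k ≟ a | k ≟ b
  ... | yes refl | _        = Sa
  ... | no _     | yes refl = Sb
  ... | no k≢a   | no k≢b   = ⊥-elim (true≢false (trans (sym xk) (cong₂ _xor_ (δ-off k≢a) (δ-off k≢b))))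
  x∈ker : InKernel M S x
  x∈ker i Si = begin
    M i · x                      ≡⟨ ·-distribˡ-+ᵛ (M i) (λ k → δ k a) (λ k → δ k b) ⟩
    M i · (λ k → δ k a) xor M i · (λ k → δ k b) ≡⟨ cong₂ _xor_ (sum-δ (M i) a) (sum-δ (M i) b) ⟩
    M i a xor M i b              ≡⟨ cong (_xor M i b) (Ma≡Mb i Si) ⟩
    M i b xor M i b              ≡⟨ xor-same (M i b) ⟩
    false ∎
    where open ≡-Reasoning

repeatedRow⇒singular : ∀ {n} {M : Matrix n} {S a b} → S a ≡ true → S b ≡ true → a ≢ b →
  (∀ j → S j ≡ true → M a j ≡ M b j) → ¬ NonSingular M S
repeatedRow⇒singular Sa Sb a≢b Ma≡Mb = repeatedColumn⇒singular Sa Sb a≢b Ma≡Mb ∘ nonSingular-transpose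

_─_ : ∀ {n} → Vector Bool n → Fin n → Vector Bool n
(S ─ r) i = if δ i r then false else S i

weight-─ : ∀ {n} (S : Vector Bool n) r → S r ≡ true → suc (weight (S ─ r)) ≡ weight S
weight-─ S zero S₀ rewrite S₀ = refl
weight-─ S (suc r) Sr = trans (sym (+-suc _ _)) (cong ((if S zero then 1 else 0) +_) (weight-─ (tail S) r Sr))

─-⊆ : ∀ {n} {S : Vector Bool n} {r i} → (S ─ r) i ≡ true → S i ≡ true
─-⊆ {S = S} {r} {i} = go (δ i r)
  where
  go : ∀ b → (if b then false else S i) ≡ true → S i ≡ true
  go false Si = Si

─-≢ : ∀ {n} {S : Vector Bool n} {r i} → (S ─ r) i ≡ true → i ≢ r
─-≢ {S = S} {i = i} S′i refl = true≢false (trans (sym S′i) (cong (if_then false else S i) (δ-diag i)))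

─-∈ : ∀ {n} {S : Vector Bool n} {r i} → S i ≡ true → i ≢ r → (S ─ r) i ≡ true
─-∈ {S = S} {i = i} Si i≢r = trans (cong (if_then false else S i) (δ-off i≢r)) Si

-- Over GF(2) the determinant is additive in a row.  With x₀ ≠ 0 killing the rows of S ∖ r,
-- a matrix X sharing those rows is non-singular iff X r · x₀ = 1 and these rows are independent,
-- i.e. their common solutions are spanned by x₀; the second condition does not depend on X.
module RowLinearity {n} {S : Vector Bool n} {r : Fin n} (Sr : S r ≡ true) (C : Matrix n) where

  Annihilated : Vector Bool n → Set
  Annihilated z = z ⊆ᵛ S × InKernel C (S ─ r) z

  private
    fewer : length (map C (support (S ─ r))) < weight S
    fewer = subst (_< weight S) (sym (trans (length-map C (support (S ─ r))) (length-support (S ─ r))))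
              (≤-reflexive (weight-─ S r Sr))
    nontrivial = underdetermined (map C (support (S ─ r))) S fewer

  x₀ : Vector Bool n
  x₀ = proj₁ nontrivial

  x₀-annihilated : Annihilated x₀
  x₀-annihilated = proj₁ (proj₂ nontrivial) ,
    All-support {P = λ i → C i · x₀ ≡ false} (S ─ r) (Allₚ.map⁻ (proj₂ (proj₂ (proj₂ nontrivial))))

  x₀≢0 : ¬ IsZero x₀
  x₀≢0 x₀≡0 = let i , x₀i = proj₁ (proj₂ (proj₂ nontrivial)) in true≢false (trans (sym x₀i) (x₀≡0 i))

  SpannedByX₀ : Set
  SpannedByX₀ = ∀ z → Annihilated z → IsZero z ⊎ z ≗ x₀

  spannedByX₀? : Dec SpannedByX₀
  spannedByX₀? = ∀-Vector? resp
    (λ z → (⊆ᵛ? z S ×-dec inKernel? C (S ─ r) z) →-dec (isZero? z ⊎-dec all? (λ i → z i ≟ᵇ x₀ i)))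
    where
    resp : ∀ {z z′} → z ≗ z′ →
      (Annihilated z → IsZero z ⊎ z ≗ x₀) → Annihilated z′ → IsZero z′ ⊎ z′ ≗ x₀
    resp z≗z′ P[z] (z′⊆S , z′∈ker)
      with P[z] ((λ i zi → z′⊆S i (trans (sym (z≗z′ i)) zi)) ,
                 λ i S′i → trans (·-congʳ (C i) z≗z′) (z′∈ker i S′i))
    ... | inj₁ z≡0  = inj₁ (λ i → trans (sym (z≗z′ i)) (z≡0 i))
    ... | inj₂ z≗x₀ = inj₂ (λ i → trans (sym (z≗z′ i)) (z≗x₀ i))

  module _ {X : Matrix n} (X≈C : ∀ i → i ≢ r → S i ≡ true → ∀ j → S j ≡ true → X i j ≡ C i j) where

    private
      sameRow : ∀ {i z} → i ≢ r → S i ≡ true → z ⊆ᵛ S → X i · z ≡ C i · z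
      sameRow i≢r Si z⊆S = ·-cong-on z⊆S (X≈C _ i≢r Si)

      toKernel : ∀ {z} → Annihilated z → X r · z ≡ false → InKernel X S z
      toKernel (z⊆S , z∈ker) Xrz i Si with i ≟ r
      ... | yes refl = Xrz
      ... | no i≢r   = trans (sameRow i≢r Si z⊆S) (z∈ker i (─-∈ {S = S} Si i≢r))

      fromKernel : ∀ {z} → z ⊆ᵛ S → InKernel X S z → Annihilated z
      fromKernel z⊆S z∈ker = z⊆S , λ i S′i →
        trans (sym (sameRow (─-≢ {S = S} S′i) (─-⊆ {S = S} S′i) z⊆S)) (z∈ker i (─-⊆ {S = S} S′i))

    nonSingular⇒pivot : NonSingular X S → X r · x₀ ≡ true
    nonSingular⇒pivot nonSing =
      ¬-not (λ Xrx₀ → x₀≢0 (nonSing x₀ (proj₁ x₀-annihilated) (toKernel x₀-annihilated Xrx₀)))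

    nonSingular⇒spanned : NonSingular X S → SpannedByX₀
    nonSingular⇒spanned nonSing z ann@(z⊆S , z∈ker) with X r · z in Xrz
    ... | false = inj₁ (nonSing z z⊆S (toKernel ann Xrz))
    ... | true  = inj₂ (λ i → xor≡false⇒≡ (z+x₀≡0 i))
      where
      ann′ : Annihilated (z +ᵛ x₀)
      ann′ = +ᵛ-⊆ᵛ z⊆S (proj₁ x₀-annihilated) , λ i S′i →
        trans (·-distribˡ-+ᵛ (C i) z x₀) (cong₂ _xor_ (z∈ker i S′i) (proj₂ x₀-annihilated i S′i))
      z+x₀≡0 : IsZero (z +ᵛ x₀)
      z+x₀≡0 = nonSing (z +ᵛ x₀) (proj₁ ann′)
        (toKernel ann′ (trans (·-distribˡ-+ᵛ (X r) z x₀) (cong₂ _xor_ Xrz (nonSingular⇒pivot nonSing))))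

    pivot∧spanned⇒nonSingular : X r · x₀ ≡ true → SpannedByX₀ → NonSingular X S
    pivot∧spanned⇒nonSingular Xrx₀ spanned z z⊆S z∈ker with spanned z (fromKernel z⊆S z∈ker)
    ... | inj₁ z≡0  = z≡0
    ... | inj₂ z≗x₀ = ⊥-elim (true≢false (trans (sym Xrx₀) (trans (sym (·-congʳ (X r) z≗x₀)) (z∈ker r Sr))))

    isNonSingular-pivot : isNonSingular X S ≡ X r · x₀ ∧ does spannedByX₀?
    isNonSingular-pivot =
      trans (isNonSingular-does (mk⇔ (λ ns → nonSingular⇒pivot ns , nonSingular⇒spanned ns)
                                     (uncurry pivot∧spanned⇒nonSingular))
                                ((X r · x₀ ≟ᵇ true) ×-dec spannedByX₀?))
            (cong (_∧ does spannedByX₀?) (does-≟ᵇ-true (X r · x₀)))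

isNonSingular-rowSum : ∀ {n} {A B C : Matrix n} {S r} → S r ≡ true →
  (∀ i → i ≢ r → S i ≡ true → ∀ j → S j ≡ true → A i j ≡ C i j) →
  (∀ i → i ≢ r → S i ≡ true → ∀ j → S j ≡ true → B i j ≡ C i j) →
  (∀ j → S j ≡ true → C r j ≡ A r j xor B r j) →
  isNonSingular C S ≡ isNonSingular A S xor isNonSingular B S
isNonSingular-rowSum {A = A} {B} {C} {S} {r} Sr A≈C B≈C Cr = begin
  isNonSingular C S                          ≡⟨ isNonSingular-pivot (λ _ _ _ _ _ → refl) ⟩
  C r · x₀ ∧ q                               ≡⟨ cong (_∧ q) Crx₀ ⟩
  (A r · x₀ xor B r · x₀) ∧ q                ≡⟨ ∧-distribʳ-xor q (A r · x₀) (B r · x₀) ⟩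
  A r · x₀ ∧ q xor B r · x₀ ∧ q
    ≡⟨ sym (cong₂ _xor_ (isNonSingular-pivot A≈C) (isNonSingular-pivot B≈C)) ⟩
  isNonSingular A S xor isNonSingular B S    ∎
  where
  open ≡-Reasoning
  open RowLinearity {S = S} {r} Sr C
  q = does spannedByX₀?
  Crx₀ : C r · x₀ ≡ A r · x₀ xor B r · x₀
  Crx₀ = trans (·-cong-on {u = C r} {v = A r +ᵛ B r} (proj₁ x₀-annihilated) Cr) (·-distribʳ-+ᵛ (A r) (B r) x₀)

-- Handle slides of D(N)

addRow addColumn replaceRow replaceColumn : ∀ {n} → Fin n → Fin n → Matrix n → Matrix n
addRow a b M i j = M i j xor (δ i a ∧ M b j)
addColumn a b M i j = M i j xor (δ j a ∧ M i b)
replaceRow a b M i j = if δ i a then M b j else M i j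
replaceColumn a b M i j = if δ j a then M i b else M i j

slideMatrix : ∀ {n} → Fin n → Fin n → Matrix n → Matrix n
slideMatrix a b N = addRow a b (addColumn a b N)

isNonSingular-addRow : ∀ {n} {S : Vector Bool n} {a} b (M : Matrix n) → S a ≡ true →
  isNonSingular (addRow a b M) S ≡ isNonSingular M S xor isNonSingular (replaceRow a b M) S
isNonSingular-addRow {a = a} b M Sa = isNonSingular-rowSum Sa unchanged (λ i i≢a _ j _ → replaced i i≢a j) rowA
  where
  unchanged : ∀ i → i ≢ a → _ → ∀ j → _ → M i j ≡ addRow a b M i j
  unchanged i i≢a _ j _ rewrite δ-off i≢a = sym (xor-identityʳ (M i j))
  replaced : ∀ i → i ≢ a → ∀ j → replaceRow a b M i j ≡ addRow a b M i j
  replaced i i≢a j rewrite δ-off i≢a = sym (xor-identityʳ (M i j))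
  rowA : ∀ j → _ → addRow a b M a j ≡ M a j xor replaceRow a b M a j
  rowA j _ rewrite δ-diag a = refl

isNonSingular-addColumn : ∀ {n} {S : Vector Bool n} {a} b (M : Matrix n) → S a ≡ true →
  isNonSingular (addColumn a b M) S ≡ isNonSingular M S xor isNonSingular (replaceColumn a b M) S
isNonSingular-addColumn {S = S} {a} b M Sa = begin
  isNonSingular (addColumn a b M) S
    ≡⟨ isNonSingular-transpose (addColumn a b M) S ⟩
  isNonSingular (addRow a b (M ᵀ)) S
    ≡⟨ isNonSingular-addRow b (M ᵀ) Sa ⟩
  isNonSingular (M ᵀ) S xor isNonSingular (replaceRow a b (M ᵀ)) S
    ≡⟨ sym (cong₂ _xor_ (isNonSingular-transpose M S) (isNonSingular-transpose (replaceColumn a b M) S)) ⟩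
  isNonSingular M S xor isNonSingular (replaceColumn a b M) S ∎
  where open ≡-Reasoning

replaceRow-singular : ∀ {n} {S : Vector Bool n} {a b} (M : Matrix n) → S a ≡ true → S b ≡ true → a ≢ b →
  isNonSingular (replaceRow a b M) S ≡ false
replaceRow-singular {a = a} {b} M Sa Sb a≢b = isNonSingular-false (repeatedRow⇒singular Sa Sb a≢b sameRows)
  where
  sameRows : ∀ j → _ → replaceRow a b M a j ≡ replaceRow a b M b j
  sameRows j _ rewrite δ-diag a | δ-off (a≢b ∘ sym) = refl

replaceColumn-singular : ∀ {n} {S : Vector Bool n} {a b} (M : Matrix n) → S a ≡ true → S b ≡ true → a ≢ b →
  isNonSingular (replaceColumn a b M) S ≡ false
replaceColumn-singular {a = a} {b} M Sa Sb a≢b = isNonSingular-false (repeatedColumn⇒singular Sa Sb a≢b sameColumns)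
  where
  sameColumns : ∀ i → _ → replaceColumn a b M i a ≡ replaceColumn a b M i b
  sameColumns i _ rewrite δ-diag a | δ-off (a≢b ∘ sym) = refl

transpose-matchˡ : ∀ {n} (i j : Fin n) → PC.transpose i j i ≡ j
transpose-matchˡ i j rewrite dec-true (i ≟ i) refl = refl

transpose-matchʳ : ∀ {n} (i j : Fin n) → PC.transpose i j j ≡ i
transpose-matchʳ i j with j ≟ i
... | yes refl = refl
... | no _ rewrite dec-true (j ≟ j) refl = refl

transpose-other : ∀ {n} {i j k : Fin n} → k ≢ i → k ≢ j → PC.transpose i j k ≡ k
transpose-other {i = i} {j} {k} k≢i k≢j rewrite dec-false (k ≟ i) k≢i | dec-false (k ≟ j) k≢j = refl

∈-≢-∉ : ∀ {n} {S : Vector Bool n} {i a} → S i ≡ true → S a ≡ false → i ≢ a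
∈-≢-∉ Si Sa refl = true≢false (trans (sym Si) Sa)

isNonSingular-slide-∉ : ∀ {n} {S : Vector Bool n} {a} b (N : Matrix n) → S a ≡ false →
  isNonSingular (slideMatrix a b N) S ≡ isNonSingular N S
isNonSingular-slide-∉ {S = S} {a} b N Sa = isNonSingular-cong unchanged
  where
  unchanged : ∀ i j → S i ≡ true → S j ≡ true → slideMatrix a b N i j ≡ N i j
  unchanged i j Si Sj rewrite δ-off (∈-≢-∉ {S = S} {i} Si Sa) | δ-off (∈-≢-∉ {S = S} {j} Sj Sa) =
    trans (xor-identityʳ _) (xor-identityʳ (N i j))

isNonSingular-slide-∈∈ : ∀ {n} {S : Vector Bool n} {a b} (N : Matrix n) → S a ≡ true → S b ≡ true → a ≢ b →
  isNonSingular (slideMatrix a b N) S ≡ isNonSingular N S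
isNonSingular-slide-∈∈ {S = S} {a} {b} N Sa Sb a≢b = begin
  isNonSingular (addRow a b Ñ) S                              ≡⟨ isNonSingular-addRow b Ñ Sa ⟩
  isNonSingular Ñ S xor isNonSingular (replaceRow a b Ñ) S
    ≡⟨ cong (isNonSingular Ñ S xor_) (replaceRow-singular Ñ Sa Sb a≢b) ⟩
  isNonSingular Ñ S xor false                                 ≡⟨ xor-identityʳ _ ⟩
  isNonSingular Ñ S                                           ≡⟨ isNonSingular-addColumn b N Sa ⟩
  isNonSingular N S xor isNonSingular (replaceColumn a b N) S
    ≡⟨ cong (isNonSingular N S xor_) (replaceColumn-singular N Sa Sb a≢b) ⟩
  isNonSingular N S xor false                                 ≡⟨ xor-identityʳ _ ⟩
  isNonSingular N S                                           ∎
  where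
  open ≡-Reasoning
  Ñ = addColumn a b N

-- When b ∉ S the handle slide moves a to b: replacing row and column a by b is the relabelling a ↦ b.
isNonSingular-slide-∈∉ : ∀ {n} {S : Vector Bool n} {a b} {N : Matrix n} → IsSymmetric N → S a ≡ true → S b ≡ false →
  isNonSingular (slideMatrix a b N) S ≡ isNonSingular N S xor isNonSingular N (S ∘ PC.transpose b a)
isNonSingular-slide-∈∉ {S = S} {a} {b} {N} symN Sa Sb = begin
  isNonSingular (addRow a b Ñ) S
    ≡⟨ isNonSingular-addRow b Ñ Sa ⟩
  isNonSingular Ñ S xor isNonSingular (replaceRow a b Ñ) S
    ≡⟨ cong₂ _xor_ (isNonSingular-addColumn b N Sa)
                   (trans (isNonSingular-cong (λ i j _ _ → rowColumn (δ i a) i j)) (isNonSingular-addColumn b R Sa)) ⟩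
  (isNonSingular N S xor isNonSingular (replaceColumn a b N) S) xor (isNonSingular R S xor isNonSingular Z S)
    ≡⟨ cong (λ t → (isNonSingular N S xor t) xor (isNonSingular R S xor isNonSingular Z S)) replacedColumn ⟩
  (isNonSingular N S xor isNonSingular R S) xor (isNonSingular R S xor isNonSingular Z S)
    ≡⟨ xor-cancel-middle (isNonSingular N S) (isNonSingular R S) (isNonSingular Z S) ⟩
  isNonSingular N S xor isNonSingular Z S
    ≡⟨ cong (isNonSingular N S xor_) relabelled ⟩
  isNonSingular N S xor isNonSingular N (S ∘ PC.transpose b a) ∎
  where
  open ≡-Reasoning
  Ñ = addColumn a b N
  R = replaceRow a b N
  Z = replaceColumn a b R
  τ = transpose a b
  rowColumn : ∀ p i j →
    (if p then Ñ b j else Ñ i j) ≡ (if p then N b j else N i j) xor (δ j a ∧ (if p then N b b else N i b))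
  rowColumn true  i j = refl
  rowColumn false i j = refl
  replacedColumn : isNonSingular (replaceColumn a b N) S ≡ isNonSingular R S
  replacedColumn = trans (isNonSingular-transpose _ S)
                         (isNonSingular-cong (λ i j _ _ → cong₂ (if δ i a then_else_) (symN j b) (symN j i)))
  τ-on-S : ∀ {i} → S i ≡ true → τ ⟨$⟩ʳ i ≡ (if δ i a then b else i)
  τ-on-S {i} Si with i ≟ a
  ... | yes refl rewrite δ-diag i = refl
  ... | no i≢a   rewrite δ-off i≢a | dec-false (i ≟ b) (∈-≢-∉ {S = S} Si Sb) = refl
  relabelling : ∀ p q i j → (if q then (if p then N b b else N i b) else (if p then N b j else N i j))
                            ≡ N (if p then b else i) (if q then b else j)
  relabelling true  true  i j = refl
  relabelling true  false i j = refl
  relabelling false true  i j = refl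
  relabelling false false i j = refl
  relabelled : isNonSingular Z S ≡ isNonSingular N (S ∘ PC.transpose b a)
  relabelled = sym (begin
    isNonSingular N (S ∘ (τ ⟨$⟩ˡ_))                   ≡⟨ isNonSingular-permute N _ τ ⟩
    isNonSingular (N ⟨ τ ⟩ₘ) (S ∘ (τ ⟨$⟩ˡ_) ∘ (τ ⟨$⟩ʳ_))
      ≡⟨ isNonSingular-resp-≗ (N ⟨ τ ⟩ₘ) (λ i → cong S (inverseˡ τ)) ⟩
    isNonSingular (N ⟨ τ ⟩ₘ) S
      ≡⟨ isNonSingular-cong (λ i j Si Sj →
           trans (cong₂ N (τ-on-S Si) (τ-on-S Sj)) (sym (relabelling (δ i a) (δ j a) i j))) ⟩
    isNonSingular Z S                                 ∎)

handleSlide-slideMatrix : ∀ {n} {N : Matrix n} {a b} → IsSymmetric N → a ≢ b →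
  ∀ X → D[ slideMatrix a b N ] X ≡ handleSlide a b D[ N ] X
handleSlide-slideMatrix {N = N} {a} {b} symN a≢b X with lookup X a in Xa | lookup X b in Xb
... | false | _     = trans (isNonSingular-slide-∉ b N Xa) (sym (xor-identityʳ _))
... | true  | true  = trans (isNonSingular-slide-∈∈ N Xa Xb a≢b) (sym (xor-identityʳ _))
... | true  | false = trans (isNonSingular-slide-∈∉ symN Xa Xb) (cong (D[ N ] X xor_) (isNonSingular-resp-≗ N moved))
  where
  moved : lookup X ∘ PC.transpose b a ≗ lookup ((X [ a ]≔ false) [ b ]≔ true)
  moved k with a ≟ k | b ≟ k
  ... | yes refl | _ = trans (cong (lookup X) (transpose-matchʳ b a))
                         (trans Xb (sym (trans (lookup∘update′ a≢b (X [ a ]≔ false) true) (lookup∘update a X false))))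
  ... | no _ | yes refl = trans (cong (lookup X) (transpose-matchˡ b a))
                            (trans Xa (sym (lookup∘update b (X [ a ]≔ false) true)))
  ... | no a≢k | no b≢k = trans (cong (lookup X) (transpose-other (b≢k ∘ sym) (a≢k ∘ sym)))
                            (sym (trans (lookup∘update′ (b≢k ∘ sym) (X [ a ]≔ false) true)
                                        (lookup∘update′ (a≢k ∘ sym) X false)))

slideMatrix-symmetric : ∀ {n} {N : Matrix n} a b → IsSymmetric N → IsSymmetric (slideMatrix a b N)
slideMatrix-symmetric {N = N} a b symN i j rewrite symN j i | symN b i | symN j b =
  sym (rowColumn-commute (δ i a) (δ j a) (N i j) (N b j) (N i b) (N b b))

-- Binary set systems with ∅ feasible

module PivotTransform {n} {N : Matrix n} (symN : IsSymmetric N) {B : Vector Bool n} (nsB : NonSingular N B) where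

  exchange : (Fin n → Bool) → Vector Bool n → Vector Bool n
  exchange c v k = if c k then N k · v else v k

  -- (swapIn v, swapOut v) is (v, N v) with the coordinates in B exchanged.
  swapIn swapOut : Vector Bool n → Vector Bool n
  swapIn = exchange B
  swapOut = exchange (not ∘ B)

  swapIn-inside : ∀ {v k} → B k ≡ true → swapIn v k ≡ N k · v
  swapIn-inside {v} {k} = cong (if_then N k · v else v k)

  swapIn-outside : ∀ {v k} → B k ≡ false → swapIn v k ≡ v k
  swapIn-outside {v} {k} = cong (if_then N k · v else v k)

  swapOut-inside : ∀ {v k} → B k ≡ true → swapOut v k ≡ v k
  swapOut-inside {v} {k} = cong (λ b → if not b then N k · v else v k)

  swapOut-outside : ∀ {v k} → B k ≡ false → swapOut v k ≡ N k · v
  swapOut-outside {v} {k} = cong (λ b → if not b then N k · v else v k)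

  exchange-+ᵛ : ∀ c a d k → exchange c (a +ᵛ d) k ≡ exchange c a k xor exchange c d k
  exchange-+ᵛ c a d k with c k
  ... | true  = ·-distribˡ-+ᵛ (N k) a d
  ... | false = refl

  exchange-cong : ∀ c {a d} → a ≗ d → exchange c a ≗ exchange c d
  exchange-cong c a≗d k with c k
  ... | true  = ·-congʳ (N k) a≗d
  ... | false = a≗d k

  exchange-combination : ∀ c (U : Matrix n) x k → exchange c (U ᵀ *ᵛ x) k ≡ sum (λ j → exchange c (U j) k ∧ x j)
  exchange-combination c U x k with c k
  ... | true  = trans (·-*ᵛ-transpose (N k) (U ᵀ) x) (sum-cong-≗ (λ j → cong (_∧ x j) (·-comm (U j) (N k))))
  ... | false = refl

  swapIn-injective : ∀ d → IsZero (swapIn d) → IsZero d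
  swapIn-injective d swapIn≡0 = nsB d d⊆B (λ k Bk → trans (sym (swapIn-inside Bk)) (swapIn≡0 k))
    where
    d⊆B : d ⊆ᵛ B
    d⊆B k dk with B k in Bk
    ... | true  = refl
    ... | false = ⊥-elim (true≢false (trans (sym dk) (trans (sym (swapIn-outside Bk)) (swapIn≡0 k))))

  outside : Fin n → Vector Bool n
  outside j k = if B k then false else δ k j

  private
    correction : ∀ j → Σ[ w ∈ Vector Bool n ] w ⊆ᵛ B × (∀ k → B k ≡ true → N k · w ≡ δ k j xor N k · outside j)
    correction j = nonSingular⇒solvable nsB (λ k → δ k j xor N k · outside j)

  -- The preimages of the unit vectors under swapIn.
  U : Matrix n
  U j = outside j +ᵛ proj₁ (correction j)

  swapIn-U : ∀ j k → swapIn (U j) k ≡ δ k j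
  swapIn-U j k = place (B k) refl
    where
    w = proj₁ (correction j)
    place : ∀ b → B k ≡ b → swapIn (U j) k ≡ δ k j
    place true Bk = begin
      swapIn (U j) k                          ≡⟨ swapIn-inside Bk ⟩
      N k · (outside j +ᵛ w)                  ≡⟨ ·-distribˡ-+ᵛ (N k) (outside j) w ⟩
      N k · outside j xor N k · w             ≡⟨ cong (N k · outside j xor_) (proj₂ (proj₂ (correction j)) k Bk) ⟩
      N k · outside j xor (δ k j xor N k · outside j) ≡⟨ xor-cancelʳ (N k · outside j) (δ k j) ⟩
      δ k j                                   ∎
      where open ≡-Reasoning
    place false Bk = begin
      swapIn (U j) k                          ≡⟨ swapIn-outside Bk ⟩
      (if B k then false else δ k j) xor w k  ≡⟨ cong₂ (λ b t → (if b then false else δ k j) xor t) Bk wk≡false ⟩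
      δ k j xor false                         ≡⟨ xor-identityʳ (δ k j) ⟩
      δ k j                                   ∎
      where
      open ≡-Reasoning
      wk≡false : w k ≡ false
      wk≡false = ¬-not (λ wk → true≢false (trans (sym (proj₁ (proj₂ (correction j)) k wk)) Bk))

  combination : Vector Bool n → Vector Bool n
  combination x = U ᵀ *ᵛ x

  swapIn-combination : ∀ x → swapIn (combination x) ≗ x
  swapIn-combination x k =
    trans (exchange-combination B U x k) (trans (sum-cong-≗ (λ j → cong (_∧ x j) (swapIn-U j k))) (sum-δˡ x k))

  combination-swapIn : ∀ v → v ≗ combination (swapIn v)
  combination-swapIn v k = xor≡false⇒≡ (swapIn-injective (v +ᵛ combination (swapIn v)) cancels k)
    where
    cancels : IsZero (swapIn (v +ᵛ combination (swapIn v)))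
    cancels m = trans (exchange-+ᵛ B v (combination (swapIn v)) m)
                      (trans (cong (swapIn v m xor_) (swapIn-combination (swapIn v) m)) (xor-same (swapIn v m)))

  pivot : Matrix n
  pivot k j = swapOut (U j) k

  swapOut-combination : ∀ x → swapOut (combination x) ≗ pivot *ᵛ x
  swapOut-combination x k = exchange-combination (not ∘ B) U x k

  graph : ∀ v → swapOut v ≗ pivot *ᵛ swapIn v
  graph v k = trans (exchange-cong (not ∘ B) (combination-swapIn v) k) (swapOut-combination (swapIn v) k)

  -- N symmetric makes the form (x, y) · (x′, y′) = x · y′ + y · x′ vanish on its graph, hence on the exchanged graph.
  swapIn·swapOut : ∀ a d → swapIn a · swapOut d ≡ swapOut a · swapIn d
  swapIn·swapOut a d = xor≡false⇒≡ (begin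
    swapIn a · swapOut d xor swapOut a · swapIn d
      ≡⟨ sym (∑-distrib-+ (λ m → swapIn a m ∧ swapOut d m) (λ m → swapOut a m ∧ swapIn d m)) ⟩
    sum (λ m → swapIn a m ∧ swapOut d m xor swapOut a m ∧ swapIn d m)
      ≡⟨ sum-cong-≗ exchanged ⟩
    sum (λ m → a m ∧ N m · d xor N m · a ∧ d m)
      ≡⟨ ∑-distrib-+ (λ m → a m ∧ N m · d) (λ m → N m · a ∧ d m) ⟩
    a · (N *ᵛ d) xor (N *ᵛ a) · d
      ≡⟨ cong (_xor (N *ᵛ a) · d)
              (trans (·-*ᵛ-transpose a N d) (·-congˡ d (λ m → ·-congˡ a (λ i → symN i m)))) ⟩
    (N *ᵛ a) · d xor (N *ᵛ a) · d
      ≡⟨ xor-same ((N *ᵛ a) · d) ⟩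
    false ∎)
    where
    open ≡-Reasoning
    exchanged : ∀ m → swapIn a m ∧ swapOut d m xor swapOut a m ∧ swapIn d m ≡ a m ∧ N m · d xor N m · a ∧ d m
    exchanged m with B m
    ... | true  = xor-comm (N m · a ∧ d m) (a m ∧ N m · d)
    ... | false = refl

  pivot-symmetric : IsSymmetric pivot
  pivot-symmetric k j = begin
    swapOut (U j) k                      ≡⟨ sym (sum-δˡ (swapOut (U j)) k) ⟩
    sum (λ m → δ k m ∧ swapOut (U j) m)
      ≡⟨ sum-cong-≗ (λ m → cong (_∧ swapOut (U j) m) (trans (δ-comm k m) (sym (swapIn-U k m)))) ⟩
    swapIn (U k) · swapOut (U j)         ≡⟨ swapIn·swapOut (U k) (U j) ⟩
    swapOut (U k) · swapIn (U j)         ≡⟨ sum-cong-≗ (λ m → cong (swapOut (U k) m ∧_) (swapIn-U j m)) ⟩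
    sum (λ m → swapOut (U k) m ∧ δ m j)  ≡⟨ sum-δ (swapOut (U k)) j ⟩
    swapOut (U k) j                      ∎
    where open ≡-Reasoning

  nonSingular-pivot⇒ : ∀ {Y} → NonSingular pivot Y → NonSingular N (B +ᵛ Y)
  nonSingular-pivot⇒ {Y} nsY v v⊆ v∈ker = swapIn-injective v (nsY (swapIn v) swapIn⊆Y swapIn∈ker)
    where
    v-off : ∀ k → B k xor Y k ≡ false → v k ≡ false
    v-off k off = ¬-not (λ vk → true≢false (trans (sym (v⊆ k vk)) off))
    swapIn⊆Y : swapIn v ⊆ᵛ Y
    swapIn⊆Y k e = place (B k) (Y k) refl refl
      where
      place : ∀ b y → B k ≡ b → Y k ≡ y → Y k ≡ true
      place _     true  _  Yk = Yk
      place true  false Bk Yk =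
        ⊥-elim (true≢false (trans (sym e) (trans (swapIn-inside Bk) (v∈ker k (cong₂ _xor_ Bk Yk)))))
      place false false Bk Yk =
        ⊥-elim (true≢false (trans (sym e) (trans (swapIn-outside Bk) (v-off k (cong₂ _xor_ Bk Yk)))))
    swapIn∈ker : InKernel pivot Y (swapIn v)
    swapIn∈ker k Yk = trans (sym (graph v k)) (place (B k) refl)
      where
      place : ∀ b → B k ≡ b → swapOut v k ≡ false
      place true  Bk = trans (swapOut-inside Bk) (v-off k (cong₂ _xor_ Bk Yk))
      place false Bk = trans (swapOut-outside Bk) (v∈ker k (cong₂ _xor_ Bk Yk))

  nonSingular-pivot⇐ : ∀ {Y} → NonSingular N (B +ᵛ Y) → NonSingular pivot Y
  nonSingular-pivot⇐ {Y} ns x x⊆Y x∈ker k = trans (sym (swapIn-combination x k)) (swapIn-zero (B k) refl)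
    where
    v = combination x
    swapOut-v : ∀ k → Y k ≡ true → swapOut v k ≡ false
    swapOut-v k Yk = trans (swapOut-combination x k) (x∈ker k Yk)
    swapIn-v : ∀ k → Y k ≡ false → swapIn v k ≡ false
    swapIn-v k Yk = trans (swapIn-combination x k) (¬-not (λ xk → true≢false (trans (sym (x⊆Y k xk)) Yk)))
    v⊆ : v ⊆ᵛ B +ᵛ Y
    v⊆ k vk = place (B k) (Y k) refl refl
      where
      place : ∀ b y → B k ≡ b → Y k ≡ y → B k xor Y k ≡ true
      place true  false Bk Yk = cong₂ _xor_ Bk Yk
      place false true  Bk Yk = cong₂ _xor_ Bk Yk
      place true  true  Bk Yk = ⊥-elim (true≢false (trans (sym vk) (trans (sym (swapOut-inside Bk)) (swapOut-v k Yk))))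
      place false false Bk Yk = ⊥-elim (true≢false (trans (sym vk) (trans (sym (swapIn-outside Bk)) (swapIn-v k Yk))))
    v∈ker : InKernel N (B +ᵛ Y) v
    v∈ker k BYk with xor≡true BYk
    ... | inj₁ (Bk , Yk) = trans (sym (swapIn-inside Bk)) (swapIn-v k Yk)
    ... | inj₂ (Bk , Yk) = trans (sym (swapOut-outside Bk)) (swapOut-v k Yk)
    v≡0 : IsZero v
    v≡0 = ns v v⊆ v∈ker
    swapIn-zero : ∀ b → B k ≡ b → swapIn v k ≡ false
    swapIn-zero true  Bk = trans (swapIn-inside Bk) (·-zeroʳ (N k) v≡0)
    swapIn-zero false Bk = trans (swapIn-outside Bk) (v≡0 k)


≗⇒≡ : ∀ {A : Set} {n} {xs ys : Vec A n} → lookup xs ≗ lookup ys → xs ≡ ys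
≗⇒≡ {xs = xs} {ys} e = trans (sym (tabulate∘lookup xs)) (trans (tabulate-cong e) (tabulate∘lookup ys))

lookup-△ : ∀ {n} (A X : Subset n) → lookup (A △ X) ≗ lookup A +ᵛ lookup X
lookup-△ A X i = lookup-zipWith _xor_ i A X

△-self : ∀ {n} (A : Subset n) → A △ A ≡ ⊥
△-self A = ≗⇒≡ (λ i → trans (lookup-△ A A i) (trans (xor-same (lookup A i)) (sym (lookup-replicate i false))))

△-involutive : ∀ {n} (A X : Subset n) → A △ (A △ X) ≡ X
△-involutive A X = ≗⇒≡ λ i → begin
  lookup (A △ (A △ X)) i                       ≡⟨ lookup-△ A (A △ X) i ⟩
  lookup A i xor lookup (A △ X) i              ≡⟨ cong (lookup A i xor_) (lookup-△ A X i) ⟩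
  lookup A i xor (lookup A i xor lookup X i)   ≡⟨ sym (xor-assoc (lookup A i) _ _) ⟩
  (lookup A i xor lookup A i) xor lookup X i   ≡⟨ cong (_xor lookup X i) (xor-same (lookup A i)) ⟩
  lookup X i                                   ∎
  where open ≡-Reasoning

xorSum≡sum : ∀ {n} (f : Vector Bool n) → xorSum f ≡ sum f
xorSum≡sum {zero} f = refl
xorSum≡sum {suc n} f = cong (f zero xor_) (xorSum≡sum (tail f))

nonSingularPrincipal⇔ : ∀ {n} {M : Matrix n} {A : Subset n} → NonSingularPrincipal M A ⇔ NonSingular M (lookup A)
nonSingularPrincipal⇔ {M = M} {A} = mk⇔ to from
  where
  to : NonSingularPrincipal M A → NonSingular M (lookup A)
  to nsp x x⊆A x∈ker i = begin
    x i                  ≡⟨ sym (lookup∘tabulate x i) ⟩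
    lookup X i           ≡⟨ cong (λ Y → lookup Y i) X≡⊥ ⟩
    lookup ⊥ i           ≡⟨ lookup-replicate i false ⟩
    false                ∎
    where
    open ≡-Reasoning
    X = tabulate x
    X≡⊥ : X ≡ ⊥
    X≡⊥ = nsp X (λ {i} i∈X → lookup⇒[]= i A (x⊆A i (trans (sym (lookup∘tabulate x i)) ([]=⇒lookup i∈X))))
            (λ i i∈A → trans (xorSum≡sum (λ j → M i j ∧ lookup X j))
                             (trans (·-congʳ (M i) (lookup∘tabulate x)) (x∈ker i ([]=⇒lookup i∈A))))
  from : NonSingular M (lookup A) → NonSingularPrincipal M A
  from ns X X⊆A X∈ker = ≗⇒≡ (λ i → trans (X≡0 i) (sym (lookup-replicate i false)))
    where
    X≡0 : IsZero (lookup X)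
    X≡0 = ns (lookup X) (λ i Xi → []=⇒lookup (X⊆A (lookup⇒[]= i X Xi)))
             (λ i Ai → trans (sym (xorSum≡sum (λ j → M i j ∧ lookup X j))) (X∈ker i (lookup⇒[]= i A Ai)))

twist-D : ∀ {n} {M : Matrix n} {A} → IsSymmetric M → D[ M ] A ≡ true →
  Σ[ N ∈ Matrix n ] IsSymmetric N × (∀ X → twist D[ M ] A X ≡ D[ N ] X)
twist-D {M = M} {A} symM DA = pivot , pivot-symmetric , λ X →
  trans (isNonSingular-resp-≗ M (lookup-△ A X)) (isNonSingular-⇔ (mk⇔ nonSingular-pivot⇐ nonSingular-pivot⇒))
  where open PivotTransform symM (isNonSingular-true⁻¹ DA)

binary⇒D : ∀ {n} (F : SetSystem n) → IsBinary F → F ⊥ ≡ true →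
  Σ[ N ∈ Matrix n ] IsSymmetric N × (∀ X → F X ≡ D[ N ] X)
binary⇒D {n} F (A , M , symM , σ , iff) F∅ =
  let N , symN , twist≡D = twist-D {A = A} (λ i j → symM (σ ⟨$⟩ʳ i) (σ ⟨$⟩ʳ j)) DA in
  N , symN , λ X → trans (cong F (sym (△-involutive A X))) (trans (twisted (A △ X)) (twist≡D X))
  where
  M′ : Matrix n
  M′ = M ⟨ σ ⟩ₘ
  twisted : ∀ X → twist F A X ≡ D[ M′ ] X
  twisted X = begin
    twist F A X                                     ≡⟨ sym (does-≟ᵇ-true (twist F A X)) ⟩
    does (twist F A X ≟ᵇ true)
      ≡⟨ sym (isNonSingular-does (mk⇔ (proj₂ (iff X) ∘ Equivalence.from nonSingularPrincipal⇔)
                                      (Equivalence.to nonSingularPrincipal⇔ ∘ proj₁ (iff X)))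
                                 (twist F A X ≟ᵇ true)) ⟩
    isNonSingular M (lookup (relabel (σ ⟨$⟩ˡ_) X))
      ≡⟨ isNonSingular-resp-≗ M (lookup∘tabulate (λ i → lookup X (σ ⟨$⟩ˡ i))) ⟩
    isNonSingular M (lookup X ∘ (σ ⟨$⟩ˡ_))          ≡⟨ isNonSingular-permute M (lookup X ∘ (σ ⟨$⟩ˡ_)) σ ⟩
    isNonSingular M′ (lookup X ∘ (σ ⟨$⟩ˡ_) ∘ (σ ⟨$⟩ʳ_))
      ≡⟨ isNonSingular-resp-≗ M′ (λ i → cong (lookup X) (inverseˡ σ)) ⟩
    D[ M′ ] X                                       ∎
    where open ≡-Reasoning
  DA : D[ M′ ] A ≡ true
  DA = trans (sym (twisted A)) (trans (cong F (△-self A)) F∅)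

lookup-relabel : ∀ {n m} (f : Fin n → Fin m) Y x → lookup (relabel f Y) x ≡ lookup Y (f x)
lookup-relabel f Y = lookup∘tabulate (lookup Y ∘ f)

relabel-∘ : ∀ {n m p} (f : Fin n → Fin m) (g : Fin m → Fin p) Y → relabel f (relabel g Y) ≡ relabel (g ∘ f) Y
relabel-∘ f g Y = ≗⇒≡ (λ x → trans (lookup-relabel f (relabel g Y) x)
                                  (trans (lookup-relabel g Y (f x)) (sym (lookup-relabel (g ∘ f) Y x))))

relabel-id : ∀ {n} {f : Fin n → Fin n} → (∀ x → f x ≡ x) → ∀ Y → relabel f Y ≡ Y
relabel-id f≗id Y = ≗⇒≡ (λ x → trans (lookup-relabel _ Y x) (cong (lookup Y) (f≗id x)))

-- A record around Isomorphic, so that unification can recover both set systems from the type.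
infix 4 _≅_
record _≅_ {n m} (F : SetSystem n) (G : SetSystem m) : Set where
  constructor ≅-intro
  field isomorphic : Isomorphic F G
open _≅_

≗⇒≅ : ∀ {n} {F G : SetSystem n} → F ≗ G → F ≅ G
≗⇒≅ {G = G} F≗G = ≅-intro (idₚ , λ X → trans (F≗G X) (cong G (sym (relabel-id (λ _ → refl) X))))

≅-sym : ∀ {n m} {F : SetSystem n} {G : SetSystem m} → F ≅ G → G ≅ F
≅-sym {F = F} {G} (≅-intro (σ , F≡G)) = ≅-intro (flip σ , λ Y → begin
  G Y                                          ≡⟨ cong G (sym (relabel-id (λ _ → inverseʳ σ) Y)) ⟩
  G (relabel ((σ ⟨$⟩ʳ_) ∘ (σ ⟨$⟩ˡ_)) Y)          ≡⟨ cong G (sym (relabel-∘ (σ ⟨$⟩ˡ_) (σ ⟨$⟩ʳ_) Y)) ⟩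
  G (relabel (σ ⟨$⟩ˡ_) (relabel (σ ⟨$⟩ʳ_) Y))    ≡⟨ sym (F≡G (relabel (σ ⟨$⟩ʳ_) Y)) ⟩
  F (relabel (σ ⟨$⟩ʳ_) Y)                       ∎)
  where open ≡-Reasoning

≅-trans : ∀ {n m p} {F : SetSystem n} {G : SetSystem m} {H : SetSystem p} → F ≅ G → G ≅ H → F ≅ H
≅-trans {H = H} (≅-intro (σ , F≡G)) (≅-intro (τ , G≡H)) = ≅-intro (σ ∘ₚ τ , λ X →
  trans (F≡G X) (trans (G≡H _) (cong H (relabel-∘ (τ ⟨$⟩ˡ_) (σ ⟨$⟩ˡ_) X))))

infixr 2 _≅⟨_⟩_
infix  3 _≅∎

_≅⟨_⟩_ : ∀ {n m p} (F : SetSystem n) {G : SetSystem m} {H : SetSystem p} → F ≅ G → G ≅ H → F ≅ H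
F ≅⟨ F≅G ⟩ G≅H = ≅-trans F≅G G≅H

_≅∎ : ∀ {n} (F : SetSystem n) → F ≅ F
F ≅∎ = ≗⇒≅ (λ _ → refl)

⟨$⟩ˡ-injective : ∀ {n m} (σ : Permutation n m) {a b} → σ ⟨$⟩ˡ a ≡ σ ⟨$⟩ˡ b → a ≡ b
⟨$⟩ˡ-injective σ = Injection.injective (↔⇒↣ (flip σ))

relabel-update : ∀ {n m} (σ : Permutation n m) (X : Subset n) a v →
  relabel (σ ⟨$⟩ˡ_) (X [ σ ⟨$⟩ˡ a ]≔ v) ≡ relabel (σ ⟨$⟩ˡ_) X [ a ]≔ v
relabel-update σ X a v = ≗⇒≡ pointwise
  where
  pointwise : ∀ k → lookup (relabel (σ ⟨$⟩ˡ_) (X [ σ ⟨$⟩ˡ a ]≔ v)) k ≡ lookup (relabel (σ ⟨$⟩ˡ_) X [ a ]≔ v) k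
  pointwise k with k ≟ a
  ... | yes refl = trans (lookup-relabel (σ ⟨$⟩ˡ_) (X [ σ ⟨$⟩ˡ k ]≔ v) k)
                     (trans (lookup∘update (σ ⟨$⟩ˡ k) X v) (sym (lookup∘update k (relabel (σ ⟨$⟩ˡ_) X) v)))
  ... | no k≢a = trans (lookup-relabel (σ ⟨$⟩ˡ_) (X [ σ ⟨$⟩ˡ a ]≔ v) k)
                   (trans (lookup∘update′ (k≢a ∘ ⟨$⟩ˡ-injective σ) X v)
                          (trans (sym (lookup-relabel (σ ⟨$⟩ˡ_) X k))
                                 (sym (lookup∘update′ k≢a (relabel (σ ⟨$⟩ˡ_) X) v))))

HandleSlideStep-≅ : ∀ {n m} {G : SetSystem n} {H K : SetSystem m} → G ≅ H → HandleSlideStep H K →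
  ∃ λ K′ → HandleSlideStep G K′ × K′ ≅ K
HandleSlideStep-≅ {G = G} {H} {K} (≅-intro (σ , G≡H)) (a , b , a≢b , K≡) =
  K ∘ relabel π , (π a , π b , a≢b ∘ ⟨$⟩ˡ-injective σ , slid) , ≅-intro (σ , λ _ → refl)
  where
  π = σ ⟨$⟩ˡ_
  slid : ∀ X → K (relabel π X) ≡ handleSlide (π a) (π b) G X
  slid X = trans (K≡ (relabel π X)) (sym (cong₂ _xor_ (G≡H X)
    (cong₂ _∧_ (sym (lookup-relabel π X a)) (cong₂ _∧_ (cong not (sym (lookup-relabel π X b)))
      (trans (G≡H _) (cong H (trans (relabel-update σ (X [ π a ]≔ false) b true)
                                    (cong (_[ b ]≔ true) (relabel-update σ X a false)))))))))

HandleSlides-≅ : ∀ {n m} {G : SetSystem n} {H K : SetSystem m} → G ≅ H → HandleSlides H K →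
  ∃ λ K′ → HandleSlides G K′ × K′ ≅ K
HandleSlides-≅ {G = G} G≅H ε = G , ε , G≅H
HandleSlides-≅ G≅H (step ◅ steps) =
  let K₁ , step′ , K₁≅ = HandleSlideStep-≅ G≅H step
      K₂ , steps′ , K₂≅ = HandleSlides-≅ K₁≅ steps
  in K₂ , step′ ◅ steps′ , K₂≅

TakesTo-≅ : ∀ {n m} {G : SetSystem n} {H : SetSystem m} {i j k} → G ≅ H → TakesTo H i j k → TakesTo G i j k
TakesTo-≅ {i = i} {j} {k} G≅H (K , slides , K≅D) =
  let K′ , slides′ , K′≅K = HandleSlides-≅ G≅H slides
  in K′ , slides′ , isomorphic (≅-trans K′≅K (≅-intro {G = Dform i j k} K≅D))

TakesTo-≗ : ∀ {n} {F G : SetSystem n} {i j k} → F ≗ G → TakesTo G i j k → TakesTo F i j k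
TakesTo-≗ {G = G} {i} {j} {k} F≗G = TakesTo-≅ {i = i} {j} {k} (≗⇒≅ {G = G} F≗G)

TakesTo-HandleSlides : ∀ {n} {F G : SetSystem n} {i j k} → HandleSlides F G → TakesTo G i j k → TakesTo F i j k
TakesTo-HandleSlides F↝G (K , G↝K , K≅D) = K , F↝G ◅◅ G↝K , K≅D

≅⇒TakesTo : ∀ {n} {F : SetSystem n} {i j k} → F ≅ Dform i j k → TakesTo F i j k
≅⇒TakesTo {F = F} F≅D = F , ε , isomorphic F≅D

handleSlide-⊕ʳ : ∀ m (H : SetSystem m) {p} (G : SetSystem p) a b →
  handleSlide (m ↑ʳ a) (m ↑ʳ b) (H ⊕ G) ≗ H ⊕ handleSlide a b G
handleSlide-⊕ʳ zero H G a b X =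
  ∧-factorˡ (H []) (G X) (lookup X a) (not (lookup X b)) (G ((X [ a ]≔ false) [ b ]≔ true))
handleSlide-⊕ʳ (suc m) H G a b (x ∷ xs) = handleSlide-⊕ʳ m (λ ys → H (x ∷ ys)) G a b xs

HandleSlideStep-⊕ʳ : ∀ {m p} (H : SetSystem m) {G G′ : SetSystem p} →
  HandleSlideStep G G′ → HandleSlideStep (H ⊕ G) (H ⊕ G′)
HandleSlideStep-⊕ʳ {m} H {G} (a , b , a≢b , G′≡) =
  m ↑ʳ a , m ↑ʳ b , a≢b ∘ ↑ʳ-injective m a b ,
  λ X → trans (cong (H (take m X) ∧_) (G′≡ (drop m X))) (sym (handleSlide-⊕ʳ m H G a b X))

HandleSlides-⊕ʳ : ∀ {m p} (H : SetSystem m) {G G′ : SetSystem p} →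
  HandleSlides G G′ → HandleSlides (H ⊕ G) (H ⊕ G′)
HandleSlides-⊕ʳ H = gmap (H ⊕_) (λ {G} {G′} → HandleSlideStep-⊕ʳ H {G} {G′})

⊕-++ : ∀ {m p} (G : SetSystem m) (H : SetSystem p) xs ys → (G ⊕ H) (xs ++ ys) ≡ G xs ∧ H ys
⊕-++ {m} G H xs ys with ++-injective (take m (xs ++ ys)) xs (take++drop≡id m (xs ++ ys))
... | take≡ , drop≡ = cong₂ (λ u v → G u ∧ H v) take≡ drop≡

handleSlide-⊕ˡ : ∀ {m p} (G : SetSystem m) (H : SetSystem p) a b →
  handleSlide (a ↑ˡ p) (b ↑ˡ p) (G ⊕ H) ≗ handleSlide a b G ⊕ H
handleSlide-⊕ˡ {m} {p} G H a b X = subst (λ Y → handleSlide (a ↑ˡ p) (b ↑ˡ p) (G ⊕ H) Y ≡ (handleSlide a b G ⊕ H) Y)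
                                         (take++drop≡id m X) (split (take m X) (drop m X))
  where
  split : ∀ xs ys → handleSlide (a ↑ˡ p) (b ↑ˡ p) (G ⊕ H) (xs ++ ys) ≡ (handleSlide a b G ⊕ H) (xs ++ ys)
  split xs ys = begin
    (G ⊕ H) (xs ++ ys) xor lookup (xs ++ ys) (a ↑ˡ p) ∧
      (not (lookup (xs ++ ys) (b ↑ˡ p)) ∧ (G ⊕ H) (((xs ++ ys) [ a ↑ˡ p ]≔ false) [ b ↑ˡ p ]≔ true))
      ≡⟨ cong₂ (λ u v → (G ⊕ H) (xs ++ ys) xor u ∧ (not v ∧ (G ⊕ H) (((xs ++ ys) [ a ↑ˡ p ]≔ false) [ b ↑ˡ p ]≔ true)))
               (lookup-++ˡ xs ys a) (lookup-++ˡ xs ys b) ⟩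
    (G ⊕ H) (xs ++ ys) xor lookup xs a ∧ (not (lookup xs b) ∧ (G ⊕ H) (((xs ++ ys) [ a ↑ˡ p ]≔ false) [ b ↑ˡ p ]≔ true))
      ≡⟨ cong (λ Y → (G ⊕ H) (xs ++ ys) xor lookup xs a ∧ (not (lookup xs b) ∧ (G ⊕ H) Y))
              (trans (cong (_[ b ↑ˡ p ]≔ true) ([]≔-++-↑ˡ xs ys a)) ([]≔-++-↑ˡ (xs [ a ]≔ false) ys b)) ⟩
    (G ⊕ H) (xs ++ ys) xor lookup xs a ∧ (not (lookup xs b) ∧ (G ⊕ H) (((xs [ a ]≔ false) [ b ]≔ true) ++ ys))
      ≡⟨ cong₂ (λ u v → u xor lookup xs a ∧ (not (lookup xs b) ∧ v)) (⊕-++ G H xs ys) (⊕-++ G H _ ys) ⟩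
    G xs ∧ H ys xor lookup xs a ∧ (not (lookup xs b) ∧ (G ((xs [ a ]≔ false) [ b ]≔ true) ∧ H ys))
      ≡⟨ ∧-factorʳ (G xs) (H ys) (lookup xs a) (not (lookup xs b)) (G ((xs [ a ]≔ false) [ b ]≔ true)) ⟩
    handleSlide a b G xs ∧ H ys
      ≡⟨ sym (⊕-++ (handleSlide a b G) H xs ys) ⟩
    (handleSlide a b G ⊕ H) (xs ++ ys) ∎
    where open ≡-Reasoning

HandleSlideStep-⊕ˡ : ∀ {m p} {G G′ : SetSystem m} (H : SetSystem p) →
  HandleSlideStep G G′ → HandleSlideStep (G ⊕ H) (G′ ⊕ H)
HandleSlideStep-⊕ˡ {m} {p} {G} H (a , b , a≢b , G′≡) =
  a ↑ˡ p , b ↑ˡ p , a≢b ∘ ↑ˡ-injective p a b ,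
  λ X → trans (cong (_∧ H (drop m X)) (G′≡ (take m X))) (sym (handleSlide-⊕ˡ G H a b X))

HandleSlides-⊕ˡ : ∀ {m p} {G G′ : SetSystem m} (H : SetSystem p) →
  HandleSlides G G′ → HandleSlides (G ⊕ H) (G′ ⊕ H)
HandleSlides-⊕ˡ H = gmap (_⊕ H) (λ {G} {G′} → HandleSlideStep-⊕ˡ {G = G} {G′} H)

liftʳ : ∀ m {p q} → (Fin p → Fin q) → Fin (m + p) → Fin (m + q)
liftʳ zero    f i       = f i
liftʳ (suc m) f zero    = zero
liftʳ (suc m) f (suc i) = suc (liftʳ m f i)

liftʳ-inverse : ∀ m {p q} {f : Fin p → Fin q} {g : Fin q → Fin p} →
  (∀ x → g (f x) ≡ x) → ∀ x → liftʳ m g (liftʳ m f x) ≡ x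
liftʳ-inverse zero    g∘f x       = g∘f x
liftʳ-inverse (suc m) g∘f zero    = refl
liftʳ-inverse (suc m) {f = f} {g} g∘f (suc x) = cong suc (liftʳ-inverse m {f = f} {g} g∘f x)

⊕-relabelʳ : ∀ m (H : SetSystem m) {p q} (G : SetSystem p) (G′ : SetSystem q) (g : Fin q → Fin p) →
  (∀ X → G X ≡ G′ (relabel g X)) → ∀ X → (H ⊕ G) X ≡ (H ⊕ G′) (relabel (liftʳ m g) X)
⊕-relabelʳ zero    H G G′ g G≡G′ X        = cong (H [] ∧_) (G≡G′ X)
⊕-relabelʳ (suc m) H G G′ g G≡G′ (x ∷ xs) = ⊕-relabelʳ m (λ ys → H (x ∷ ys)) G G′ g G≡G′ xs

≅-⊕ʳ : ∀ {m p q} (H : SetSystem m) {G : SetSystem p} {G′ : SetSystem q} → G ≅ G′ → H ⊕ G ≅ H ⊕ G′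
≅-⊕ʳ {m} H {G} {G′} (≅-intro (σ , G≡G′)) = ≅-intro (
  permutation (liftʳ m (σ ⟨$⟩ʳ_)) (liftʳ m (σ ⟨$⟩ˡ_))
              (liftʳ-inverse m (λ _ → inverseʳ σ)) (liftʳ-inverse m (λ _ → inverseˡ σ)) ,
  ⊕-relabelʳ m H G G′ (σ ⟨$⟩ˡ_) G≡G′)

≗-⊕ʳ : ∀ {m p} (H : SetSystem m) {G G′ : SetSystem p} → G ≗ G′ → H ⊕ G ≗ H ⊕ G′
≗-⊕ʳ {m} H G≗G′ X = cong (H (take m X) ∧_) (G≗G′ (drop m X))

⊕-swap₁₁ : ∀ {m} (H₁ H₂ : SetSystem 1) (G : SetSystem m) → H₁ ⊕ (H₂ ⊕ G) ≅ H₂ ⊕ (H₁ ⊕ G)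
⊕-swap₁₁ H₁ H₂ G = ≅-intro (transpose zero (suc zero) , λ where
  (x ∷ y ∷ xs) → trans (∧-swapˡ (H₁ (x ∷ [])) (H₂ (y ∷ [])) (G xs))
                       (cong (λ v → H₂ (y ∷ []) ∧ (H₁ (x ∷ []) ∧ G v)) (sym (tabulate∘lookup xs))))

⊕-swap₁₂ : ∀ {m} (H₁ : SetSystem 1) (H₂ : SetSystem 2) (G : SetSystem m) → H₁ ⊕ (H₂ ⊕ G) ≅ H₂ ⊕ (H₁ ⊕ G)
⊕-swap₁₂ H₁ H₂ G = ≅-intro (transpose (suc zero) zero ∘ₚ transpose (suc (suc zero)) (suc zero) , λ where
  (x ∷ y ∷ z ∷ xs) → trans (∧-swapˡ (H₁ (x ∷ [])) (H₂ (y ∷ z ∷ [])) (G xs))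
                           (cong (λ v → H₂ (y ∷ z ∷ []) ∧ (H₁ (x ∷ []) ∧ G v)) (sym (tabulate∘lookup xs))))

loopDM-⊕-Dform : ∀ i j k → loopDM ⊕ Dform i j k ≗ Dform (suc i) j k
loopDM-⊕-Dform i j k (x ∷ xs) = sym (∧-assoc (loopDM (x ∷ [])) _ _)

pairDM-⊕-Dform₀ : ∀ j k → pairDM ⊕ Dform 0 j k ≗ Dform 0 (suc j) k
pairDM-⊕-Dform₀ j k (x ∷ y ∷ xs) = sym (∧-assoc (pairDM (x ∷ y ∷ [])) _ _)

freeDM-⊕-Dform₀₀ : ∀ k → freeDM ⊕ Dform 0 0 k ≗ Dform 0 0 (suc k)
freeDM-⊕-Dform₀₀ k (x ∷ xs) = refl

freeDM-⊕-Dform : ∀ i j k → freeDM ⊕ Dform i j k ≅ Dform i j (suc k)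
freeDM-⊕-Dform (suc i) j k =
  freeDM ⊕ Dform (suc i) j k      ≅⟨ ≗⇒≅ (≗-⊕ʳ freeDM (λ X → sym (loopDM-⊕-Dform i j k X))) ⟩
  freeDM ⊕ (loopDM ⊕ Dform i j k) ≅⟨ ⊕-swap₁₁ freeDM loopDM (Dform i j k) ⟩
  loopDM ⊕ (freeDM ⊕ Dform i j k) ≅⟨ ≅-⊕ʳ loopDM (freeDM-⊕-Dform i j k) ⟩
  loopDM ⊕ Dform i j (suc k)      ≅⟨ ≗⇒≅ (loopDM-⊕-Dform i j (suc k)) ⟩
  Dform (suc i) j (suc k)         ≅∎
freeDM-⊕-Dform zero (suc j) k =
  freeDM ⊕ Dform 0 (suc j) k      ≅⟨ ≗⇒≅ (≗-⊕ʳ freeDM (λ X → sym (pairDM-⊕-Dform₀ j k X))) ⟩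
  freeDM ⊕ (pairDM ⊕ Dform 0 j k) ≅⟨ ⊕-swap₁₂ freeDM pairDM (Dform 0 j k) ⟩
  pairDM ⊕ (freeDM ⊕ Dform 0 j k) ≅⟨ ≅-⊕ʳ pairDM (freeDM-⊕-Dform 0 j k) ⟩
  pairDM ⊕ Dform 0 j (suc k)      ≅⟨ ≗⇒≅ (pairDM-⊕-Dform₀ j (suc k)) ⟩
  Dform 0 (suc j) (suc k)         ≅∎
freeDM-⊕-Dform zero zero k = ≗⇒≅ (freeDM-⊕-Dform₀₀ k)

pairDM-⊕-Dform : ∀ i j k → pairDM ⊕ Dform i j k ≅ Dform i (suc j) k
pairDM-⊕-Dform zero j k = ≗⇒≅ (pairDM-⊕-Dform₀ j k)
pairDM-⊕-Dform (suc i) j k =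
  pairDM ⊕ Dform (suc i) j k      ≅⟨ ≗⇒≅ (≗-⊕ʳ pairDM (λ X → sym (loopDM-⊕-Dform i j k X))) ⟩
  pairDM ⊕ (loopDM ⊕ Dform i j k) ≅⟨ ≅-sym (⊕-swap₁₂ loopDM pairDM (Dform i j k)) ⟩
  loopDM ⊕ (pairDM ⊕ Dform i j k) ≅⟨ ≅-⊕ʳ loopDM (pairDM-⊕-Dform i j k) ⟩
  loopDM ⊕ Dform i (suc j) k      ≅⟨ ≗⇒≅ (loopDM-⊕-Dform i (suc j) k) ⟩
  Dform (suc i) (suc j) k         ≅∎

TakesTo-⊕ʳ : ∀ {m p} (H : SetSystem m) {G : SetSystem p} {i j k i′ j′ k′} →
  TakesTo G i j k → H ⊕ Dform i j k ≅ Dform i′ j′ k′ → TakesTo (H ⊕ G) i′ j′ k′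
TakesTo-⊕ʳ H {i = i} {j} {k} (K , G↝K , K≅D) H⊕D≅D′ =
  H ⊕ K , HandleSlides-⊕ʳ H G↝K , isomorphic (≅-trans (≅-⊕ʳ H (≅-intro {G = Dform i j k} K≅D)) H⊕D≅D′)

D-permute : ∀ {n} (N : Matrix n) (π : Permutation′ n) → D[ N ] ≅ D[ N ⟨ π ⟩ₘ ]
D-permute N π = ≅-intro (flip π , λ X →
  trans (isNonSingular-permute N (lookup X) π)
        (isNonSingular-resp-≗ (N ⟨ π ⟩ₘ) (λ i → sym (lookup-relabel (π ⟨$⟩ʳ_) X i))))

-- Reduction to normal form

module SplitFirstElement {m} {N : Matrix (suc m)} (symN : IsSymmetric N) (column₀ : ∀ c → N (suc c) zero ≡ false) where

  N₊ : Matrix m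
  N₊ i j = N (suc i) (suc j)

  private
    row₀· : ∀ x → N zero · x ≡ N zero zero ∧ x zero
    row₀· x = trans (cong (N zero zero ∧ x zero xor_)
                          (sum-zero (λ j → cong (_∧ x (suc j)) (trans (symN zero (suc j)) (column₀ j)))))
                    (xor-identityʳ _)

    rowₛ· : ∀ i x → N (suc i) · x ≡ N₊ i · tail x
    rowₛ· i x = cong (λ t → t ∧ x zero xor N₊ i · tail x) (column₀ i)

  D-drop : ∀ {x₀} xs → x₀ ≡ false ⊎ N zero zero ≡ true → D[ N ] (x₀ ∷ xs) ≡ D[ N₊ ] xs
  D-drop {x₀} xs allowed = isNonSingular-⇔ (mk⇔ restrict extend)
    where
    restrict : NonSingular N (lookup (x₀ ∷ xs)) → NonSingular N₊ (lookup xs)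
    restrict ns y y⊆ y∈ker i = ns (false ◂ y) ⊆ ker (suc i)
      where
      ⊆ : (false ◂ y) ⊆ᵛ lookup (x₀ ∷ xs)
      ⊆ (suc i) yi = y⊆ i yi
      ker : InKernel N (lookup (x₀ ∷ xs)) (false ◂ y)
      ker zero    _  = trans (row₀· (false ◂ y)) (∧-zeroʳ (N zero zero))
      ker (suc i) Si = trans (rowₛ· i (false ◂ y)) (y∈ker i Si)
    extend : NonSingular N₊ (lookup xs) → NonSingular N (lookup (x₀ ∷ xs))
    extend ns x x⊆ x∈ker = λ where
        zero    → ¬-not (λ x0 → true≢false ([ excluded x0 , pivot x0 ] allowed))
        (suc i) → ns (tail x) (λ i → x⊆ (suc i)) (λ i Si → trans (sym (rowₛ· i x)) (x∈ker (suc i) Si)) i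
      where
      excluded : x zero ≡ true → x₀ ≡ false → true ≡ false
      excluded x0 x₀≡false = trans (sym (x⊆ zero x0)) x₀≡false
      pivot : x zero ≡ true → N zero zero ≡ true → true ≡ false
      pivot x0 N00 = trans (sym (cong₂ _∧_ N00 x0)) (trans (sym (row₀· x)) (x∈ker zero (x⊆ zero x0)))

  D-singular : N zero zero ≡ false → ∀ xs → D[ N ] (true ∷ xs) ≡ false
  D-singular N00 xs = isNonSingular-false (λ ns → true≢false (ns e₀ ⊆ ker zero))
    where
    e₀ : Vector Bool (suc m)
    e₀ = true ◂ λ _ → false
    ⊆ : e₀ ⊆ᵛ lookup (true ∷ xs)
    ⊆ zero _ = refl
    ker : InKernel N (lookup (true ∷ xs)) e₀
    ker zero    _ = trans (row₀· e₀) (cong (_∧ true) N00)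
    ker (suc i) _ = trans (rowₛ· i e₀) (·-zeroʳ (N₊ i) (λ _ → refl))

  D-loop : N zero zero ≡ false → D[ N ] ≗ loopDM ⊕ D[ N₊ ]
  D-loop N00 (true  ∷ xs) = D-singular N00 xs
  D-loop N00 (false ∷ xs) = D-drop xs (inj₁ refl)

  D-free : N zero zero ≡ true → D[ N ] ≗ freeDM ⊕ D[ N₊ ]
  D-free N00 (x ∷ xs) = D-drop xs (inj₂ N00)

module SplitFirstPair {m} {N : Matrix (suc (suc m))} (symN : IsSymmetric N)
  (N₀₀ : N zero zero ≡ false) (N₁₁ : N (suc zero) (suc zero) ≡ false) (N₀₁ : N zero (suc zero) ≡ true)
  (column₀ : ∀ c → N (suc (suc c)) zero ≡ false) (column₁ : ∀ c → N (suc (suc c)) (suc zero) ≡ false) where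

  N₊ : Matrix m
  N₊ i j = N (suc (suc i)) (suc (suc j))

  private
    rest-zero : ∀ r → (∀ c → N (suc (suc c)) r ≡ false) → ∀ (x : Vector Bool (suc (suc m))) →
      sum (λ j → N r (suc (suc j)) ∧ x (suc (suc j))) ≡ false
    rest-zero r column x = sum-zero (λ j → cong (_∧ x (suc (suc j))) (trans (symN r (suc (suc j))) (column j)))

    row₀· : ∀ x → N zero · x ≡ x (suc zero)
    row₀· x = trans (cong₂ (λ p q → p ∧ x zero xor (q ∧ x (suc zero) xor sum (λ j → N zero (suc (suc j)) ∧ x (suc (suc j)))))
                           N₀₀ N₀₁)
                    (trans (cong (x (suc zero) xor_) (rest-zero zero column₀ x)) (xor-identityʳ _))

    row₁· : ∀ x → N (suc zero) · x ≡ x zero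
    row₁· x = trans (cong₂ (λ p q → p ∧ x zero xor (q ∧ x (suc zero) xor sum (λ j → N (suc zero) (suc (suc j)) ∧ x (suc (suc j)))))
                           (trans (symN (suc zero) zero) N₀₁) N₁₁)
                    (trans (cong (x zero xor_) (rest-zero (suc zero) column₁ x)) (xor-identityʳ _))

    rowₛ· : ∀ i x → N (suc (suc i)) · x ≡ N₊ i · tail (tail x)
    rowₛ· i x = cong₂ (λ p q → p ∧ x zero xor (q ∧ x (suc zero) xor N₊ i · tail (tail x))) (column₀ i) (column₁ i)

  D-drop : ∀ b xs → D[ N ] (b ∷ b ∷ xs) ≡ D[ N₊ ] xs
  D-drop b xs = isNonSingular-⇔ (mk⇔ restrict extend)
    where
    restrict : NonSingular N (lookup (b ∷ b ∷ xs)) → NonSingular N₊ (lookup xs)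
    restrict ns y y⊆ y∈ker i = ns (false ◂ false ◂ y) ⊆ ker (suc (suc i))
      where
      ⊆ : (false ◂ false ◂ y) ⊆ᵛ lookup (b ∷ b ∷ xs)
      ⊆ (suc (suc i)) yi = y⊆ i yi
      ker : InKernel N (lookup (b ∷ b ∷ xs)) (false ◂ false ◂ y)
      ker zero          _  = row₀· (false ◂ false ◂ y)
      ker (suc zero)    _  = row₁· (false ◂ false ◂ y)
      ker (suc (suc i)) Si = trans (rowₛ· i (false ◂ false ◂ y)) (y∈ker i Si)
    -- Both coordinates of the pair lie in S or neither does, so each is forced to 0 by the other's row.
    extend : NonSingular N₊ (lookup xs) → NonSingular N (lookup (b ∷ b ∷ xs))
    extend ns x x⊆ x∈ker = λ where
        zero          → ¬-not (λ x0 → true≢false (trans (sym x0) (trans (sym (row₁· x)) (x∈ker (suc zero) (x⊆ zero x0)))))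
        (suc zero)    → ¬-not (λ x1 → true≢false (trans (sym x1) (trans (sym (row₀· x)) (x∈ker zero (x⊆ (suc zero) x1)))))
        (suc (suc i)) → ns (tail (tail x)) (λ i → x⊆ (suc (suc i)))
                           (λ i Si → trans (sym (rowₛ· i x)) (x∈ker (suc (suc i)) Si)) i

  D-singular : ∀ b xs → D[ N ] (b ∷ not b ∷ xs) ≡ false
  D-singular b xs = isNonSingular-false (λ ns → e≢0 (ns e ⊆ ker))
    where
    e : Vector Bool (suc (suc m))
    e = b ◂ not b ◂ λ _ → false
    ⊆ : e ⊆ᵛ lookup (b ∷ not b ∷ xs)
    ⊆ zero       eb = eb
    ⊆ (suc zero) eb = eb
    ker : InKernel N (lookup (b ∷ not b ∷ xs)) e
    ker zero          b≡true  = trans (row₀· e) (cong not b≡true)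
    ker (suc zero)    ¬b≡true = trans (row₁· e) (trans (sym (not-involutive b)) (cong not ¬b≡true))
    ker (suc (suc i)) _       = trans (rowₛ· i e) (·-zeroʳ (N₊ i) (λ _ → refl))
    e≢0 : ¬ IsZero e
    e≢0 e≡0 = true≢false (trans (sym (cong not (e≡0 zero))) (e≡0 (suc zero)))

  D-pair : D[ N ] ≗ pairDM ⊕ D[ N₊ ]
  D-pair (true  ∷ true  ∷ xs) = D-drop true xs
  D-pair (false ∷ false ∷ xs) = D-drop false xs
  D-pair (true  ∷ false ∷ xs) = D-singular true xs
  D-pair (false ∷ true  ∷ xs) = D-singular false xs

slideIf : ∀ {n} → Bool → Fin n → Fin n → Matrix n → Matrix n
slideIf true  a b N = slideMatrix a b N
slideIf false a b N = N

slideIf-unchanged : ∀ {n} t (a b : Fin n) N i j → i ≢ a → j ≢ a → slideIf t a b N i j ≡ N i j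
slideIf-unchanged true  a b N i j i≢a j≢a rewrite δ-off i≢a | δ-off j≢a =
  trans (xor-identityʳ _) (xor-identityʳ (N i j))
slideIf-unchanged false a b N i j _   _   = refl

slideIf-row : ∀ {n} t (a b : Fin n) N j → j ≢ a → slideIf t a b N a j ≡ N a j xor t ∧ N b j
slideIf-row true a b N j j≢a rewrite δ-diag a | δ-off j≢a =
  trans (cong (_xor (N b j xor false)) (xor-identityʳ (N a j))) (cong (N a j xor_) (xor-identityʳ (N b j)))
slideIf-row false a b N j _ = sym (xor-identityʳ (N a j))

slideIf-clears : ∀ {n} (a b : Fin n) N j → j ≢ a → N b j ≡ true → slideIf (N a j) a b N a j ≡ false
slideIf-clears a b N j j≢a Nbj =
  trans (slideIf-row (N a j) a b N j j≢a)
        (trans (cong (λ u → N a j xor N a j ∧ u) Nbj) (trans (cong (N a j xor_) (∧-identityʳ (N a j))) (xor-same (N a j))))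

module _ {n} {N : Matrix n} (symN : IsSymmetric N) {a b : Fin n} (a≢b : a ≢ b) where

  slideIf-symmetric : ∀ t → IsSymmetric (slideIf t a b N)
  slideIf-symmetric true  = slideMatrix-symmetric a b symN
  slideIf-symmetric false = symN

  slideIf-HandleSlides : ∀ t → HandleSlides D[ N ] D[ slideIf t a b N ]
  slideIf-HandleSlides true  = (a , b , a≢b , handleSlide-slideMatrix symN a≢b) ◅ ε
  slideIf-HandleSlides false = ε

FreeCleared : ∀ {m} → Matrix (suc m) → List (Fin m) → Set
FreeCleared {m} N cs = Σ[ N′ ∈ Matrix (suc m) ] IsSymmetric N′ × HandleSlides D[ N ] D[ N′ ] ×
  N′ zero zero ≡ true × (∀ c → c ∈ cs → N′ (suc c) zero ≡ false)

clearFree-step : ∀ {m} {N : Matrix (suc m)} {cs} c → FreeCleared N cs → FreeCleared N (c ∷ cs)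
clearFree-step {cs = cs} c (N₁ , sym₁ , slides₁ , pivot₁ , cleared₁) =
  slideIf t (suc c) zero N₁ , slideIf-symmetric sym₁ (λ ()) t , slides₁ ◅◅ slideIf-HandleSlides sym₁ (λ ()) t ,
  trans (slideIf-unchanged t (suc c) zero N₁ zero zero (λ ()) (λ ())) pivot₁ , cleared
  where
  t = N₁ (suc c) zero
  cleared : ∀ c′ → c′ ∈ c ∷ cs → slideIf t (suc c) zero N₁ (suc c′) zero ≡ false
  cleared c′ c′∈ with c′ ≟ c | c′∈
  ... | yes refl | _              = slideIf-clears (suc c) zero N₁ zero (λ ()) pivot₁
  ... | no c′≢c  | here c′≡c      = ⊥-elim (c′≢c c′≡c)
  ... | no c′≢c  | there c′∈cs    =
    trans (slideIf-unchanged t (suc c) zero N₁ (suc c′) zero (c′≢c ∘ suc-injective) (λ ())) (cleared₁ c′ c′∈cs)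

clearFree : ∀ {m} cs {N : Matrix (suc m)} → IsSymmetric N → N zero zero ≡ true → FreeCleared N cs
clearFree []       {N} symN pivot = N , symN , ε , pivot , λ _ ()
clearFree (c ∷ cs)     symN pivot = clearFree-step c (clearFree cs symN pivot)

PairCleared : ∀ {m} → Matrix (suc (suc m)) → List (Fin m) → Set
PairCleared {m} N cs = Σ[ N′ ∈ Matrix (suc (suc m)) ] IsSymmetric N′ × HandleSlides D[ N ] D[ N′ ] ×
  N′ zero zero ≡ false × N′ (suc zero) (suc zero) ≡ false × N′ zero (suc zero) ≡ true ×
  (∀ c → c ∈ cs → N′ (suc (suc c)) zero ≡ false × N′ (suc (suc c)) (suc zero) ≡ false)

-- Row a is cleared in column 0 by sliding it over 1, then in column 1 by sliding it over 0.
clearPair-step : ∀ {m} {N : Matrix (suc (suc m))} {cs} c → PairCleared N cs → PairCleared N (c ∷ cs)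
clearPair-step {cs = cs} c (N₁ , sym₁ , slides₁ , N₁00 , N₁11 , N₁01 , cleared₁) =
  N₃ , slideIf-symmetric sym₂ (λ ()) t₂ ,
  slides₁ ◅◅ slideIf-HandleSlides sym₁ (λ ()) t₁ ◅◅ slideIf-HandleSlides sym₂ (λ ()) t₂ ,
  trans (kept (λ ()) (λ ())) N₁00 , trans (kept (λ ()) (λ ())) N₁11 , trans (kept (λ ()) (λ ())) N₁01 , cleared
  where
  a = suc (suc c)
  t₁ = N₁ a zero
  N₂ = slideIf t₁ a (suc zero) N₁
  sym₂ = slideIf-symmetric sym₁ (λ ()) t₁
  t₂ = N₂ a (suc zero)
  N₃ = slideIf t₂ a zero N₂
  kept : ∀ {i j} → i ≢ a → j ≢ a → N₃ i j ≡ N₁ i j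
  kept {i} {j} i≢a j≢a =
    trans (slideIf-unchanged t₂ a zero N₂ i j i≢a j≢a) (slideIf-unchanged t₁ a (suc zero) N₁ i j i≢a j≢a)
  N₂a0 : N₂ a zero ≡ false
  N₂a0 = slideIf-clears a (suc zero) N₁ zero (λ ()) (trans (sym₁ (suc zero) zero) N₁01)
  N₃a0 : N₃ a zero ≡ false
  N₃a0 = trans (slideIf-row t₂ a zero N₂ zero (λ ()))
               (trans (cong₂ (λ u v → u xor t₂ ∧ v) N₂a0
                             (trans (slideIf-unchanged t₁ a (suc zero) N₁ zero zero (λ ()) (λ ())) N₁00))
                      (∧-zeroʳ t₂))
  N₃a1 : N₃ a (suc zero) ≡ false
  N₃a1 = slideIf-clears a zero N₂ (suc zero) (λ ())
           (trans (slideIf-unchanged t₁ a (suc zero) N₁ zero (suc zero) (λ ()) (λ ())) N₁01)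
  cleared : ∀ c′ → c′ ∈ c ∷ cs → N₃ (suc (suc c′)) zero ≡ false × N₃ (suc (suc c′)) (suc zero) ≡ false
  cleared c′ c′∈ with c′ ≟ c | c′∈
  ... | yes refl | _           = N₃a0 , N₃a1
  ... | no c′≢c  | here c′≡c   = ⊥-elim (c′≢c c′≡c)
  ... | no c′≢c  | there c′∈cs =
    let ≢a = c′≢c ∘ suc-injective ∘ suc-injective
    in trans (kept ≢a (λ ())) (proj₁ (cleared₁ c′ c′∈cs)) , trans (kept ≢a (λ ())) (proj₂ (cleared₁ c′ c′∈cs))

clearPair : ∀ {m} cs {N : Matrix (suc (suc m))} → IsSymmetric N →
  N zero zero ≡ false → N (suc zero) (suc zero) ≡ false → N zero (suc zero) ≡ true → PairCleared N cs
clearPair []       {N} symN N00 N11 N01 = N , symN , ε , N00 , N11 , N01 , λ _ ()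
clearPair (c ∷ cs)     symN N00 N11 N01 = clearPair-step c (clearPair cs symN N00 N11 N01)

HasNormalForm : ∀ {n} → SetSystem n → Set
HasNormalForm F = ∃[ i ] ∃[ j ] ∃[ k ] TakesTo F i j k

NormalForms : ℕ → Set
NormalForms n = ∀ (N : Matrix n) → IsSymmetric N → HasNormalForm D[ N ]

loopCase : ∀ {m} {N : Matrix (suc m)} → IsSymmetric N → (∀ j → N zero j ≡ false) → NormalForms m → HasNormalForm D[ N ]
loopCase {N = N} symN row₀ normalForms =
  let i , j , k , N₊↝D = normalForms N₊ (λ i j → symN (suc i) (suc j))
  in suc i , j , k ,
     TakesTo-≗ {i = suc i} {j} {k} (D-loop (row₀ zero))
       (TakesTo-⊕ʳ loopDM {i = i} {j} {k} {suc i} {j} {k} N₊↝D (≗⇒≅ (loopDM-⊕-Dform i j k)))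
  where
  column₀ : ∀ c → N (suc c) zero ≡ false
  column₀ c = trans (symN (suc c) zero) (row₀ (suc c))
  open SplitFirstElement symN column₀

freeCase : ∀ {m} {N : Matrix (suc m)} → IsSymmetric N → N zero zero ≡ true → NormalForms m → HasNormalForm D[ N ]
freeCase {m} symN N00 normalForms =
  let N′ , sym′ , slides , pivot , cleared = clearFree (allFin m) symN N00
      open SplitFirstElement sym′ (λ c → cleared c (∈-allFin c))
      i , j , k , N₊↝D = normalForms N₊ (λ i j → sym′ (suc i) (suc j))
  in i , j , suc k ,
     TakesTo-HandleSlides {i = i} {j} {suc k} slides
       (TakesTo-≗ {i = i} {j} {suc k} (D-free pivot)
         (TakesTo-⊕ʳ freeDM {i = i} {j} {k} {i} {j} {suc k} N₊↝D (freeDM-⊕-Dform i j k)))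

pairCase : ∀ {m} {N : Matrix (suc (suc m))} → IsSymmetric N →
  N zero zero ≡ false → N (suc zero) (suc zero) ≡ false → N zero (suc zero) ≡ true → NormalForms m → HasNormalForm D[ N ]
pairCase {m} symN N00 N11 N01 normalForms =
  let N′ , sym′ , slides , N′00 , N′11 , N′01 , cleared = clearPair (allFin m) symN N00 N11 N01
      open SplitFirstPair sym′ N′00 N′11 N′01 (λ c → proj₁ (cleared c (∈-allFin c))) (λ c → proj₂ (cleared c (∈-allFin c)))
      i , j , k , N₊↝D = normalForms N₊ (λ i j → sym′ (suc (suc i)) (suc (suc j)))
  in i , suc j , k ,
     TakesTo-HandleSlides {i = i} {suc j} {k} slides
       (TakesTo-≗ {i = i} {suc j} {k} D-pair
         (TakesTo-⊕ʳ pairDM {i = i} {j} {k} {i} {suc j} {k} N₊↝D (pairDM-⊕-Dform i j k)))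

⟨⟩ₘ-symmetric : ∀ {n} {N : Matrix n} (π : Permutation′ n) → IsSymmetric N → IsSymmetric (N ⟨ π ⟩ₘ)
⟨⟩ₘ-symmetric π symN i j = symN (π ⟨$⟩ʳ i) (π ⟨$⟩ʳ j)

HasNormalForm-permute : ∀ {n} {N : Matrix n} (π : Permutation′ n) → HasNormalForm D[ N ⟨ π ⟩ₘ ] → HasNormalForm D[ N ]
HasNormalForm-permute {N = N} π (i , j , k , N↝D) = i , j , k , TakesTo-≅ {i = i} {j} {k} (D-permute N π) N↝D

-- A nonzero entry N 0 a: if N 0 0 = 1 element 0 is free; otherwise the transposition that brings a next
-- to 0 yields either a free element (N a a = 1) or a pair.
nonzeroRowCase : ∀ {n} {N : Matrix (suc n)} → IsSymmetric N → ∀ a → N zero a ≡ true →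
  NormalForms n → NormalForms (pred n) → HasNormalForm D[ N ]
nonzeroRowCase symN zero N00 normalForms _ = freeCase symN N00 normalForms
nonzeroRowCase {zero} symN (suc ()) _ _ _
nonzeroRowCase {suc m} {N} symN (suc a) N0a normalForms normalForms₂ with N zero zero in N00 | N (suc a) (suc a) in Naa
... | true  | _     = freeCase symN N00 normalForms
... | false | true  = HasNormalForm-permute τ (freeCase (⟨⟩ₘ-symmetric τ symN) N′00 normalForms)
  where
  τ = transpose zero (suc a)
  N′00 : (N ⟨ τ ⟩ₘ) zero zero ≡ true
  N′00 = trans (cong₂ N (transpose-matchˡ zero (suc a)) (transpose-matchˡ zero (suc a))) Naa
... | false | false = HasNormalForm-permute τ (pairCase (⟨⟩ₘ-symmetric τ symN) N00 N′11 N′01 normalForms₂)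
  where
  τ = transpose (suc zero) (suc a)
  N′11 : (N ⟨ τ ⟩ₘ) (suc zero) (suc zero) ≡ false
  N′11 = trans (cong₂ N (transpose-matchˡ (suc zero) (suc a)) (transpose-matchˡ (suc zero) (suc a))) Naa
  N′01 : (N ⟨ τ ⟩ₘ) zero (suc zero) ≡ true
  N′01 = trans (cong (N zero) (transpose-matchˡ (suc zero) (suc a))) N0a

normalForm-suc : ∀ {n} → NormalForms n → NormalForms (pred n) → NormalForms (suc n)
normalForm-suc normalForms normalForms₂ N symN with any? (λ j → N zero j ≟ᵇ true)
... | yes (a , N0a) = nonzeroRowCase symN a N0a normalForms normalForms₂
... | no ∄          = loopCase symN (λ j → ¬-not (λ N0j → ∄ (j , N0j))) normalForms

normalForm : ∀ n → NormalForms n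
normalForm zero          N _ = 0 , 0 , 0 , ≅⇒TakesTo {i = 0} {0} {0} (≗⇒≅ (λ { [] → isNonSingular-true (λ _ _ _ ()) }))
normalForm (suc zero)        = normalForm-suc (normalForm zero) (normalForm zero)
normalForm (suc (suc m))     = normalForm-suc (normalForm (suc m)) (normalForm m)

freePair↝threeFree : HandleSlides (freeDM ⊕ pairDM) (freeDM ⊕ (freeDM ⊕ freeDM))
freePair↝threeFree =
  (zero , suc zero , (λ ()) , λ _ → refl) ◅
  (suc (suc zero) , zero , (λ ()) , λ _ → refl) ◅
  (suc zero , suc (suc zero) , (λ ()) , allFeasible) ◅ ε
  where
  allFeasible : ∀ X → true ≡ handleSlide (suc zero) (suc (suc zero))
                                (handleSlide (suc (suc zero)) zero (handleSlide zero (suc zero) (freeDM ⊕ pairDM))) X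
  allFeasible (true  ∷ true  ∷ true  ∷ []) = refl
  allFeasible (true  ∷ true  ∷ false ∷ []) = refl
  allFeasible (true  ∷ false ∷ true  ∷ []) = refl
  allFeasible (true  ∷ false ∷ false ∷ []) = refl
  allFeasible (false ∷ true  ∷ true  ∷ []) = refl
  allFeasible (false ∷ true  ∷ false ∷ []) = refl
  allFeasible (false ∷ false ∷ true  ∷ []) = refl
  allFeasible (false ∷ false ∷ false ∷ []) = refl

TakesTo-freePair : ∀ {n} {F : SetSystem n} {i j k} → TakesTo F i (suc j) (suc k) → TakesTo F i j (suc (suc (suc k)))
TakesTo-freePair {i = i} {j} {k} (G , F↝G , G≅D) =
  TakesTo-HandleSlides {i = i} {j} {3 + k} F↝G
    (TakesTo-≅ {i = i} {j} {3 + k} (≅-trans (≅-intro {G = Dform i (suc j) (suc k)} G≅D) D≅freePair)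
      (TakesTo-≗ {i = i} {j} {3 + k} freePair-reassoc
        (TakesTo-HandleSlides {i = i} {j} {3 + k} (HandleSlides-⊕ˡ (Dform i j k) freePair↝threeFree)
          (TakesTo-≗ {i = i} {j} {3 + k} threeFree-reassoc (≅⇒TakesTo {i = i} {j} {3 + k} threeFree≅D)))))
  where
  freePair-reassoc : freeDM ⊕ (pairDM ⊕ Dform i j k) ≗ (freeDM ⊕ pairDM) ⊕ Dform i j k
  freePair-reassoc (x ∷ y ∷ z ∷ xs) = refl
  threeFree-reassoc : (freeDM ⊕ (freeDM ⊕ freeDM)) ⊕ Dform i j k ≗ freeDM ⊕ (freeDM ⊕ (freeDM ⊕ Dform i j k))
  threeFree-reassoc (x ∷ y ∷ z ∷ xs) = refl
  D≅freePair : Dform i (suc j) (suc k) ≅ freeDM ⊕ (pairDM ⊕ Dform i j k)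
  D≅freePair =
    Dform i (suc j) (suc k)            ≅⟨ ≅-sym (freeDM-⊕-Dform i (suc j) k) ⟩
    freeDM ⊕ Dform i (suc j) k         ≅⟨ ≅-⊕ʳ freeDM (≅-sym (pairDM-⊕-Dform i j k)) ⟩
    freeDM ⊕ (pairDM ⊕ Dform i j k)    ≅∎
  threeFree≅D : freeDM ⊕ (freeDM ⊕ (freeDM ⊕ Dform i j k)) ≅ Dform i j (3 + k)
  threeFree≅D =
    freeDM ⊕ (freeDM ⊕ (freeDM ⊕ Dform i j k)) ≅⟨ ≅-⊕ʳ freeDM (≅-⊕ʳ freeDM (freeDM-⊕-Dform i j k)) ⟩
    freeDM ⊕ (freeDM ⊕ Dform i j (suc k))      ≅⟨ ≅-⊕ʳ freeDM (freeDM-⊕-Dform i j (suc k)) ⟩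
    freeDM ⊕ Dform i j (2 + k)                 ≅⟨ freeDM-⊕-Dform i j (2 + k) ⟩
    Dform i j (3 + k)                          ≅∎

TakesTo-noPairs : ∀ {n} {F : SetSystem n} i j k → TakesTo F i j (suc k) → ∃ λ k′ → TakesTo F i 0 (suc k′)
TakesTo-noPairs i zero    k F↝D = k , F↝D
TakesTo-noPairs i (suc j) k F↝D = TakesTo-noPairs i j (suc (suc k)) (TakesTo-freePair {i = i} {j} {k} F↝D)

-- Sizes of feasible sets

FeasibleSize : ∀ {n} → SetSystem n → ℕ → Set
FeasibleSize {n} F s = Σ[ X ∈ Subset n ] F X ≡ true × ∣ X ∣ ≡ s

∣[]≔false∣ : ∀ {n} (X : Subset n) i → lookup X i ≡ true → suc ∣ X [ i ]≔ false ∣ ≡ ∣ X ∣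
∣[]≔false∣ (true  ∷ X) zero    _  = refl
∣[]≔false∣ (true  ∷ X) (suc i) Xi = cong suc (∣[]≔false∣ X i Xi)
∣[]≔false∣ (false ∷ X) (suc i) Xi = ∣[]≔false∣ X i Xi

∣[]≔true∣ : ∀ {n} (X : Subset n) i → lookup X i ≡ false → ∣ X [ i ]≔ true ∣ ≡ suc ∣ X ∣
∣[]≔true∣ (false ∷ X) zero    _  = refl
∣[]≔true∣ (true  ∷ X) (suc i) Xi = cong suc (∣[]≔true∣ X i Xi)
∣[]≔true∣ (false ∷ X) (suc i) Xi = ∣[]≔true∣ X i Xi

∣moved∣ : ∀ {n} (X : Subset n) {a b} → b ≢ a → lookup X a ≡ true → lookup X b ≡ false →
  ∣ (X [ a ]≔ false) [ b ]≔ true ∣ ≡ ∣ X ∣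
∣moved∣ X {a} {b} b≢a Xa Xb =
  trans (∣[]≔true∣ (X [ a ]≔ false) b (trans (lookup∘update′ b≢a X false) Xb)) (∣[]≔false∣ X a Xa)

-- A handle slide of a over b only adds or removes sets X ∪ {a} with X ∪ {b} feasible, of the same size.
HandleSlideStep-FeasibleSize : ∀ {n} {F G : SetSystem n} → HandleSlideStep F G → ∀ {s} → FeasibleSize F s ⇔ FeasibleSize G s
HandleSlideStep-FeasibleSize {n} {F} {G} (a , b , a≢b , G≡) = mk⇔ forward backward
  where
  moved : Subset n → Subset n
  moved X = (X [ a ]≔ false) [ b ]≔ true
  slid : Subset n → Bool
  slid X = lookup X a ∧ (not (lookup X b) ∧ F (moved X))
  a∉moved : ∀ X → lookup (moved X) a ≡ false
  a∉moved X = trans (lookup∘update′ a≢b (X [ a ]≔ false) true) (lookup∘update a X false)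
  G-moved : ∀ X → G (moved X) ≡ F (moved X)
  G-moved X = trans (G≡ (moved X))
    (trans (cong (λ t → F (moved X) xor t ∧ (not (lookup (moved X) b) ∧ F (moved (moved X)))) (a∉moved X))
           (xor-identityʳ (F (moved X))))
  move : ∀ {s} X → slid X ≡ true → ∣ X ∣ ≡ s → Σ[ Y ∈ Subset n ] F Y ≡ true × G Y ≡ true × ∣ Y ∣ ≡ s
  move X slidX ∣X∣ = let Xa , Xb , FY = ∧³-true slidX
    in moved X , FY , trans (G-moved X) FY , trans (∣moved∣ X (a≢b ∘ sym) Xa Xb) ∣X∣
  forward : ∀ {s} → FeasibleSize F s → FeasibleSize G s
  forward (X , FX , ∣X∣) with G X in GX
  ... | true  = X , GX , ∣X∣
  ... | false = let Y , _ , GY , ∣Y∣ = move X (trans (sym (xor≡false⇒≡ (trans (sym (G≡ X)) GX))) FX) ∣X∣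
                in Y , GY , ∣Y∣
  backward : ∀ {s} → FeasibleSize G s → FeasibleSize F s
  backward (X , GX , ∣X∣) with F X in FX
  ... | true  = X , FX , ∣X∣
  ... | false = let Y , FY , _ , ∣Y∣ = move X (trans (sym (cong (_xor slid X) FX)) (trans (sym (G≡ X)) GX)) ∣X∣
                in Y , FY , ∣Y∣

HandleSlides-FeasibleSize : ∀ {n} {F G : SetSystem n} → HandleSlides F G → ∀ {s} → FeasibleSize F s ⇔ FeasibleSize G s
HandleSlides-FeasibleSize ε              = ⇔-id _
HandleSlides-FeasibleSize (step ◅ steps) = HandleSlides-FeasibleSize steps ⇔-∘ HandleSlideStep-FeasibleSize step

indicator : Bool → ℕ
indicator b = if b then 1 else 0

∣∣≡sumℕ : ∀ {n} (X : Subset n) → ∣ X ∣ ≡ sumℕ (λ i → indicator (lookup X i))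
∣∣≡sumℕ []          = refl
∣∣≡sumℕ (true  ∷ X) = cong suc (∣∣≡sumℕ X)
∣∣≡sumℕ (false ∷ X) = ∣∣≡sumℕ X

∣relabel∣ : ∀ {n m} (σ : Permutation n m) X → ∣ relabel (σ ⟨$⟩ˡ_) X ∣ ≡ ∣ X ∣
∣relabel∣ σ X = begin
  ∣ relabel (σ ⟨$⟩ˡ_) X ∣                        ≡⟨ ∣∣≡sumℕ (relabel (σ ⟨$⟩ˡ_) X) ⟩
  sumℕ (λ i → indicator (lookup (relabel (σ ⟨$⟩ˡ_) X) i))
    ≡⟨ sumℕ-cong-≗ (λ i → cong indicator (lookup-relabel (σ ⟨$⟩ˡ_) X i)) ⟩
  sumℕ (λ i → indicator (lookup X (σ ⟨$⟩ˡ i)))    ≡⟨ sym (sumℕ-permute (λ i → indicator (lookup X i)) (flip σ)) ⟩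
  sumℕ (λ i → indicator (lookup X i))             ≡⟨ sym (∣∣≡sumℕ X) ⟩
  ∣ X ∣                                            ∎
  where open ≡-Reasoning

≅-FeasibleSize : ∀ {n m} {F : SetSystem n} {G : SetSystem m} → F ≅ G → ∀ {s} → FeasibleSize F s ⇔ FeasibleSize G s
≅-FeasibleSize F≅G = mk⇔ (transport F≅G) (transport (≅-sym F≅G))
  where
  transport : ∀ {n m} {F : SetSystem n} {G : SetSystem m} → F ≅ G → ∀ {s} → FeasibleSize F s → FeasibleSize G s
  transport (≅-intro (σ , F≡G)) (X , FX , ∣X∣) =
    relabel (σ ⟨$⟩ˡ_) X , trans (sym (F≡G X)) FX , trans (∣relabel∣ σ X) ∣X∣

TakesTo-FeasibleSize : ∀ {n} {F : SetSystem n} i j k → TakesTo F i j k → ∀ {s} → FeasibleSize F s ⇔ FeasibleSize (Dform i j k) s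
TakesTo-FeasibleSize i j k (G , F↝G , G≅D) =
  ≅-FeasibleSize (≅-intro {G = Dform i j k} G≅D) ⇔-∘ HandleSlides-FeasibleSize F↝G

∣++∣ : ∀ {m n} (xs : Subset m) (ys : Subset n) → ∣ xs ++ ys ∣ ≡ ∣ xs ∣ + ∣ ys ∣
∣++∣ []           ys = refl
∣++∣ (true  ∷ xs) ys = cong suc (∣++∣ xs ys)
∣++∣ (false ∷ xs) ys = ∣++∣ xs ys

FeasibleSize-⊕ : ∀ {m p} {G : SetSystem m} {H : SetSystem p} {s t} →
  FeasibleSize G s → FeasibleSize H t → FeasibleSize (G ⊕ H) (s + t)
FeasibleSize-⊕ {G = G} {H} (X , GX , ∣X∣) (Y , HY , ∣Y∣) =
  X ++ Y , trans (⊕-++ G H X Y) (cong₂ _∧_ GX HY) , trans (∣++∣ X Y) (cong₂ _+_ ∣X∣ ∣Y∣)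

FeasibleSize-⊕⁻ : ∀ {m p} {G : SetSystem m} {H : SetSystem p} {u} →
  FeasibleSize (G ⊕ H) u → ∃₂ λ s t → u ≡ s + t × FeasibleSize G s × FeasibleSize H t
FeasibleSize-⊕⁻ {m} {G = G} {H} (Z , GHZ , ∣Z∣) =
  ∣ take m Z ∣ , ∣ drop m Z ∣ , trans (sym ∣Z∣) (trans (cong ∣_∣ (sym (take++drop≡id m Z))) (∣++∣ (take m Z) (drop m Z))) ,
  (take m Z , ∧-conicalˡ _ _ GHZ , refl) , (drop m Z , ∧-conicalʳ (G (take m Z)) _ GHZ , refl)

FeasibleSize-≤ : ∀ {n} {F : SetSystem n} {s} → FeasibleSize F s → s ≤ n
FeasibleSize-≤ {n} (X , _ , ∣X∣) = subst (_≤ n) ∣X∣ (∣p∣≤n X)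

FeasibleSize-copies : ∀ {m} {F : SetSystem m} {s} k → FeasibleSize F s → FeasibleSize (copies k F) (k * s)
FeasibleSize-copies zero    _  = [] , refl , refl
FeasibleSize-copies (suc k) Fs = FeasibleSize-⊕ Fs (FeasibleSize-copies k Fs)

loops-empty : ∀ i {s} → FeasibleSize (copies i loopDM) s → s ≡ 0
loops-empty zero    ([] , _ , ∣X∣) = sym ∣X∣
loops-empty (suc i) Fs with FeasibleSize-⊕⁻ {G = loopDM} {copies i loopDM} Fs
... | s , t , u≡s+t , (false ∷ [] , _ , ∣X∣) , rest = trans u≡s+t (cong₂ _+_ (sym ∣X∣) (loops-empty i rest))

pairDM-even : ∀ {s} → FeasibleSize pairDM s → s % 2 ≡ 0
pairDM-even (true  ∷ true  ∷ [] , _ , refl) = refl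
pairDM-even (false ∷ false ∷ [] , _ , refl) = refl

pairs-even : ∀ j {s} → FeasibleSize (copies j pairDM) s → s % 2 ≡ 0
pairs-even zero    ([] , _ , ∣X∣) = cong (_% 2) (sym ∣X∣)
pairs-even (suc j) Fs with FeasibleSize-⊕⁻ {G = pairDM} {copies j pairDM} Fs
... | s , t , u≡s+t , pair , rest =
  trans (cong (_% 2) u≡s+t)
        (trans (%-distribˡ-+ s t 2) (cong₂ (λ a b → (a + b) % 2) (pairDM-even pair) (pairs-even j rest)))

loopDM-∅ : FeasibleSize loopDM 0
loopDM-∅ = false ∷ [] , refl , refl

pairDM-∅ : FeasibleSize pairDM 0
pairDM-∅ = false ∷ false ∷ [] , refl , refl

pairDM-full : FeasibleSize pairDM 2
pairDM-full = true ∷ true ∷ [] , refl , refl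

freeDM-∅ : FeasibleSize freeDM 0
freeDM-∅ = false ∷ [] , refl , refl

freeDM-full : FeasibleSize freeDM 1
freeDM-full = true ∷ [] , refl , refl

Dform-feasible : ∀ i j k {a b c} → FeasibleSize (copies i loopDM) a → FeasibleSize (copies j pairDM) b →
  FeasibleSize (copies k freeDM) c → FeasibleSize (Dform i j k) (a + (b + c))
Dform-feasible i j k loops pairs frees = FeasibleSize-⊕ loops (FeasibleSize-⊕ pairs frees)

Dform-∅ : ∀ i j k → FeasibleSize (Dform i j k) 0
Dform-∅ i j k = subst (FeasibleSize (Dform i j k)) zeros
  (Dform-feasible i j k (FeasibleSize-copies i loopDM-∅) (FeasibleSize-copies j pairDM-∅) (FeasibleSize-copies k freeDM-∅))
  where
  zeros : i * 0 + (j * 0 + k * 0) ≡ 0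
  zeros rewrite *-zeroʳ i | *-zeroʳ j | *-zeroʳ k = refl

Dform-singleton : ∀ i j k → FeasibleSize (Dform i j (suc k)) 1
Dform-singleton i j k = subst (FeasibleSize (Dform i j (suc k))) one
  (Dform-feasible i j (suc k) (FeasibleSize-copies i loopDM-∅) (FeasibleSize-copies j pairDM-∅)
                  (FeasibleSize-⊕ freeDM-full (FeasibleSize-copies k freeDM-∅)))
  where
  one : i * 0 + (j * 0 + (1 + k * 0)) ≡ 1
  one rewrite *-zeroʳ i | *-zeroʳ j | *-zeroʳ k = refl

Dform-full : ∀ i j k → FeasibleSize (Dform i j k) (j * 2 + k * 1)
Dform-full i j k = subst (FeasibleSize (Dform i j k)) (cong (_+ (j * 2 + k * 1)) (*-zeroʳ i))
  (Dform-feasible i j k (FeasibleSize-copies i loopDM-∅) (FeasibleSize-copies j pairDM-full) (FeasibleSize-copies k freeDM-full))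

Dform-bounded : ∀ i j k {s} → FeasibleSize (Dform i j k) s → s ≤ j * 2 + k * 1
Dform-bounded i j k Fs with FeasibleSize-⊕⁻ {G = copies i loopDM} {copies j pairDM ⊕ copies k freeDM} Fs
... | s₁ , s₂ , s≡ , loops , rest =
  subst (_≤ j * 2 + k * 1) (sym (trans s≡ (cong (_+ s₂) (loops-empty i loops)))) (FeasibleSize-≤ rest)

Dform-even : ∀ i j {s} → FeasibleSize (Dform i j 0) s → s % 2 ≡ 0
Dform-even i j {s} Fs with FeasibleSize-⊕⁻ {G = copies i loopDM} {copies j pairDM ⊕ copies 0 freeDM} Fs
... | s₁ , s₂ , s≡ , loops , rest with FeasibleSize-⊕⁻ {G = copies j pairDM} {copies 0 freeDM} rest
...   | t₁ , t₂ , s₂≡ , pairs , none = begin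
  s % 2               ≡⟨ cong (_% 2) (trans s≡ (cong (_+ s₂) (loops-empty i loops))) ⟩
  s₂ % 2              ≡⟨ cong (_% 2) (trans s₂≡ (cong (t₁ +_) (n≤0⇒n≡0 (FeasibleSize-≤ none)))) ⟩
  (t₁ + 0) % 2        ≡⟨ cong (_% 2) (+-identityʳ t₁) ⟩
  t₁ % 2              ≡⟨ pairs-even j pairs ⟩
  0                   ∎
  where open ≡-Reasoning

-- Uniqueness of the normal form

-- Parity decides whether k = 0, and then the rank j * 2 + k * 1 determines j and k.
pairsFrees-unique : ∀ {j k q r} → (j ≡ 0 ⊎ k ≡ 0) → (q ≡ 0 ⊎ r ≡ 0) → (k ≡ 0 → r ≡ 0) → (r ≡ 0 → k ≡ 0) →
  j * 2 + k * 1 ≡ q * 2 + r * 1 → (j , k) ≡ (q , r)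
pairsFrees-unique {j} {zero} {q} {zero} _ _ _ _ rank =
  cong (_, 0) (*-cancelʳ-≡ j q 2 (trans (sym (+-identityʳ (j * 2))) (trans rank (+-identityʳ (q * 2)))))
pairsFrees-unique {zero} {suc k} {zero} {suc r} _ _ _ _ rank = cong (0 ,_) (*-cancelʳ-≡ (suc k) (suc r) 1 rank)
pairsFrees-unique {suc j} {suc k} (inj₁ ()) _ _ _ _
pairsFrees-unique {k = suc k} (inj₂ ()) _ _ _ _
pairsFrees-unique {q = suc q} {r = suc r} _ (inj₁ ()) _ _ _
pairsFrees-unique {r = suc r} _ (inj₂ ()) _ _ _
pairsFrees-unique {k = zero} {r = suc r} _ _ k≡0⇒r≡0 _ _ with k≡0⇒r≡0 refl
... | ()
pairsFrees-unique {k = suc k} {r = zero} _ _ _ r≡0⇒k≡0 _ with r≡0⇒k≡0 refl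
... | ()

module _ {n} {F : SetSystem n} where

  private
    to : ∀ {i j k} → TakesTo F i j k → ∀ {s} → FeasibleSize F s → FeasibleSize (Dform i j k) s
    to {i} {j} {k} F↝D = Equivalence.to (TakesTo-FeasibleSize i j k F↝D)
    from : ∀ {i j k} → TakesTo F i j k → ∀ {s} → FeasibleSize (Dform i j k) s → FeasibleSize F s
    from {i} {j} {k} F↝D = Equivalence.from (TakesTo-FeasibleSize i j k F↝D)

  TakesTo-size : ∀ i j k → TakesTo F i j k → n ≡ i * 1 + (j * 2 + k * 1)
  TakesTo-size i j k (_ , _ , σ , _) = ↔⇒≡ σ

  -- j * 2 + k * 1 is the largest size of a feasible set.
  TakesTo-rank : ∀ i j k p q r → TakesTo F i j k → TakesTo F p q r → j * 2 + k * 1 ≡ q * 2 + r * 1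
  TakesTo-rank i j k p q r F↝D F↝D′ =
    ≤-antisym (Dform-bounded p q r (to {p} {q} {r} F↝D′ (from {i} {j} {k} F↝D (Dform-full i j k))))
              (Dform-bounded i j k (to {i} {j} {k} F↝D (from {p} {q} {r} F↝D′ (Dform-full p q r))))

  TakesTo-loops : ∀ i j k p q r → TakesTo F i j k → TakesTo F p q r → i ≡ p
  TakesTo-loops i j k p q r F↝D F↝D′ = begin
    i      ≡⟨ sym (*-identityʳ i) ⟩
    i * 1  ≡⟨ +-cancelʳ-≡ (j * 2 + k * 1) (i * 1) (p * 1) sizes ⟩
    p * 1  ≡⟨ *-identityʳ p ⟩
    p      ∎
    where
    open ≡-Reasoning
    sizes : i * 1 + (j * 2 + k * 1) ≡ p * 1 + (j * 2 + k * 1)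
    sizes = trans (sym (TakesTo-size i j k F↝D))
                  (trans (TakesTo-size p q r F↝D′) (cong (p * 1 +_) (sym (TakesTo-rank i j k p q r F↝D F↝D′))))

  TakesTo-even : ∀ i j → TakesTo F i j 0 → IsEven F
  TakesTo-even i j F↝D X Y FX FY = trans (even X FX) (sym (even Y FY))
    where
    even : ∀ Z → F Z ≡ true → ∣ Z ∣ % 2 ≡ 0
    even Z FZ = Dform-even i j (to {i} {j} {0} F↝D (Z , FZ , refl))

  TakesTo-odd : ∀ i j k → TakesTo F i j (suc k) → ¬ IsEven F
  TakesTo-odd i j k F↝D even
    with from {i} {j} {suc k} F↝D (Dform-∅ i j (suc k)) | from {i} {j} {suc k} F↝D (Dform-singleton i j k)
  ... | X , FX , ∣X∣ | Y , FY , ∣Y∣ with trans (sym (cong (_% 2) ∣X∣)) (trans (even X Y FX FY) (cong (_% 2) ∣Y∣))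
  ... | ()

  TakesTo-parity : ∀ i j k p q r → TakesTo F i j k → TakesTo F p q r → k ≡ 0 → r ≡ 0
  TakesTo-parity i j k p q zero    _   _    _   = refl
  TakesTo-parity i j k p q (suc r) F↝D F↝D′ k≡0 =
    ⊥-elim (TakesTo-odd p q r F↝D′ (TakesTo-even i j (subst (TakesTo F i j) k≡0 F↝D)))

  TakesTo-unique : ∀ i j k p q r → (j ≡ 0 ⊎ k ≡ 0) → (q ≡ 0 ⊎ r ≡ 0) →
    TakesTo F i j k → TakesTo F p q r → (i , j , k) ≡ (p , q , r)
  TakesTo-unique i j k p q r j,k q,r F↝D F↝D′ =
    cong₂ _,_ (TakesTo-loops i j k p q r F↝D F↝D′)
      (pairsFrees-unique j,k q,r (TakesTo-parity i j k p q r F↝D F↝D′) (TakesTo-parity p q r i j k F↝D′ F↝D)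
                         (TakesTo-rank i j k p q r F↝D F↝D′))

theorem1p2 : ∀ (n : ℕ) (F : SetSystem n) →
    IsDeltaMatroid F → IsBinary F → F ⊥ ≡ true →
    ((IsEven F → ∃[ i ] ∃[ j ] TakesTo F i j 0) ×
     (¬ IsEven F → ∃[ i ] ∃[ k ] (k ≢ 0 × TakesTo F i 0 k))) ×
    (∀ i j k p q r → TakesTo F i j k → TakesTo F p q r → i ≡ p) ×
    (∀ i j k p q r → (j ≡ 0 ⊎ k ≡ 0) → (q ≡ 0 ⊎ r ≡ 0) →
       TakesTo F i j k → TakesTo F p q r → (i , j , k) ≡ (p , q , r))
theorem1p2 n F _ binary F∅ =
  let N , symN , F≗D = binary⇒D F binary F∅
      i , j , k , D↝ = normalForm n N symN
      F↝ = TakesTo-≗ {i = i} {j} {k} F≗D D↝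
  in (evenForm i j k F↝ , oddForm i j k F↝) , TakesTo-loops , TakesTo-unique
  where
  evenForm : ∀ i j k → TakesTo F i j k → IsEven F → ∃[ i ] ∃[ j ] TakesTo F i j 0
  evenForm i j zero    F↝ _    = i , j , F↝
  evenForm i j (suc k) F↝ even = ⊥-elim (TakesTo-odd i j k F↝ even)
  oddForm : ∀ i j k → TakesTo F i j k → ¬ IsEven F → ∃[ i ] ∃[ k ] (k ≢ 0 × TakesTo F i 0 k)
  oddForm i j zero    F↝ odd = ⊥-elim (odd (TakesTo-even i j F↝))
  oddForm i j (suc k) F↝ _   = let k′ , F↝′ = TakesTo-noPairs i j k F↝ in i , suc k′ , (λ ()) , F↝′
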